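{- Let $r_1,r_2\in\mathbb{Z}$ and let $(U_n)_{n\ge0}$ be a sequence of integers with $U_n=r_1U_{n-1}+r_2U_{n-2}$ for all $n\ge2$, where the roots of $x^2-r_1x-r_2$ are distinct. Then the sequence $(U_{n^2})_{n\ge1}$ almost satisfies the Dold condition.
   Context: A sequence of integers $(A_n)_{n\ge1}$ satisfies the Dold condition if $n\mid\sum_{d\mid n}\mu(d)A_{n/d}$ for every $n\in\mathbb{N}_+$ ($\mu$ the Möbius function). It almost satisfies the Dold condition if there is $c\in\mathbb{N}_+$ such that $(cA_n)_{n\ge1}$ satisfies the Dold condition. -}

module Defs where

open import Data.Nat as ℕ using (ℕ; zero; suc)
open import Data.Nat.Divisibility using (_∣?_)
open import Data.Nat.DivMod using (_/_)
open import Data.Nat.Primality using (prime?)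
open import Data.Integer as ℤ using (ℤ; +_; -_)
open import Data.List using (List; upTo; filter; length; map; foldr)
open import Relation.Binary.PropositionalEquality using (_≡_)

divisors : ℕ → List ℕ
divisors n = filter (_∣? n) (map suc (upTo n))

primeDivisors : ℕ → List ℕ
primeDivisors n = filter prime? (divisors n)

signPow : ℕ → ℤ
signPow zero = + 1
signPow (suc k) = - signPow k

μ : ℕ → ℤ
μ n with length (filter (λ p → (p ℕ.* p) ∣? n) (primeDivisors n))
... | suc _ = + 0
... | zero  = signPow (length (primeDivisors n))

sumℤ : List ℤ → ℤ
sumℤ = foldr ℤ._+_ (+ 0)

-- n / d for d ≥ 1 (d = suc k); defined as 0 for d = 0 (never used)
div : ℕ → ℕ → ℕ
div n zero = 0
div n (suc k) = n / suc k

doldSum : (ℕ → ℤ) → ℕ → ℤ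
doldSum A n = sumℤ (map (λ d → μ d ℤ.* A (div n d)) (divisors n))

-- Dold condition for a sequence (A n)_{n ≥ 1} (value at 0 irrelevant)
Dold : (ℕ → ℤ) → Set
Dold A = ∀ (n : ℕ) → 1 ℕ.≤ n → (+ n) ℤD.∣ doldSum A n
  where import Data.Integer.Divisibility as ℤD

AlmostDold : (ℕ → ℤ) → Set
AlmostDold A = Σ ℕ (λ c → 1 ℕ.≤ c × Dold (λ n → + c ℤ.* A n))
  where open import Data.Product using (Σ; _×_)

module Submission where

open import Defs
open import Data.Nat as ℕ using (ℕ; suc)
open import Data.Integer as ℤ using (ℤ; +_)
open import Relation.Binary.PropositionalEquality using (_≢_; _≡_)
open import Data.Nat.Properties using (n≢0⇒n>0)
open import Data.Integer.Properties using (∣i∣≡0⇒i≡0)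
open import Data.Product using (_,_)
open import Algebra.Bundles using (CommutativeRing)
open import Function using (_∘_)

-- Let D = r₁² + 4r₂ and ℤ[ω] = ℤ[x]/(x² − r₁x − r₂). For the ℤ-linear map Λ sending 1, ω to
-- U₀, U₁ the recurrence gives Uₙ = Λ(ωⁿ), so congruences in ℤ[ω] transfer to U.
-- A sequence B satisfies the Dold condition as soon as it satisfies the Euler congruences
-- B(pm) ≡ B(m) (mod p^(k+1)) whenever p^k ∣ m: in the Möbius sum over the divisors of pm the
-- multiples of p² drop out and the remaining divisors pair up as d, pd.
-- For B(n) = ∣D∣ U(n²), m = q p^k and γ = ω^(q²) this is ∣D∣ γ^(p^(2k+2)) ≡ ∣D∣ γ^(p^(2k))
-- (mod p^(k+1)). Frobenius gives γ^(p²) ≡ γ (mod p) if p ∤ D and γ^(p²) ≡ γ^p if p ∣ D, and the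
-- binomial theorem lifts x ≡ y (mod p^j) to x^p ≡ y^p (mod p^(j+1)). In the first case this proves
-- the congruence even modulo p^(2k+1); in the second only modulo p^k, and the factor ∣D∣
-- supplies the missing p.

module Arithmetic where

  import Data.Integer.Divisibility.Signed as ℤD
  open import Data.Integer.DivMod using (_%ℕ_; _/ℕ_; a≡a%ℕn+[a/ℕn]*n; n%ℕd<d)
  import Data.Integer.Properties as ℤP
  open import Data.Integer.Tactic.RingSolver using (solve-∀)
  open import Data.List using ([]; _∷_)
  open import Data.List.Relation.Unary.All using (All; []; _∷_)
  open import Data.Nat using (zero; _*_; _^_; _!; _∸_; _<_; NonZero; s≤s)
  open import Data.Nat.Combinatorics using (_C_; k![n∸k]!∣n!)
  open import Data.Nat.Combinatorics.Specification using (nCk≡n!/k![n-k]!)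
  open import Data.Nat.DivMod using (_%_; _/_; m≡m%n+[m/n]*n; m%n<n; m/n*n≡m)
  open import Data.Nat.Divisibility
  open import Data.Nat.ListAction using (product)
  open import Data.Nat.Primality using (Prime; euclidsLemma; prime⇒irreducible; prime⇒nonZero; ¬prime[1])
  open import Data.Nat.Primality.Factorisation using (PrimeFactorisation; factorise)
  open import Data.Nat.Properties using (*-comm; *-assoc; *-identityʳ; +-identityʳ; *-cancelˡ-≡; _≟_; <⇒≱; <⇒≤; <-trans; n<1+n; ∸-monoʳ-<; _!*_!≢0)
  open import Data.Product using (∃; _,_)
  open import Data.Sum using (_⊎_; inj₁; inj₂)
  open import Relation.Binary.PropositionalEquality
  open import Relation.Nullary using (contradiction; yes; no)

  prime∣prime⇒≡ : ∀ {p q} → Prime p → Prime q → q ∣ p → q ≡ p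
  prime∣prime⇒≡ pp qq q∣p with prime⇒irreducible pp q∣p
  ... | inj₁ refl = contradiction qq ¬prime[1]
  ... | inj₂ q≡p = q≡p

  d∣p*m∧p∤d⇒d∣m : ∀ {p d m} → Prime p → p ∤ d → d ∣ p * m → d ∣ m
  d∣p*m∧p∤d⇒d∣m {p} {d} {m} pp p∤d (divides r pm≡rd) with euclidsLemma r d pp (divides m (trans (sym pm≡rd) (*-comm p m)))
  ... | inj₂ p∣d = contradiction p∣d p∤d
  ... | inj₁ (divides s refl) = divides s (*-cancelˡ-≡ m (s * d) p (trans pm≡rd (trans (cong (_* d) (*-comm s p)) (*-assoc p s d))))
    where instance _ = prime⇒nonZero pp

  p^k∣m*n∧p∤m⇒p^k∣n : ∀ {p m} k {n} → Prime p → p ∤ m → p ^ k ∣ m * n → p ^ k ∣ n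
  p^k∣m*n∧p∤m⇒p^k∣n zero _ _ _ = 1∣ _
  p^k∣m*n∧p∤m⇒p^k∣n {p} {m} (suc k) {n} pp p∤m p^k+1∣mn with euclidsLemma m n pp (∣-trans (m∣m*n (p ^ k)) p^k+1∣mn)
  ... | inj₁ p∣m = contradiction p∣m p∤m
  ... | inj₂ (divides r refl) = subst (p ^ suc k ∣_) (*-comm p r) (*-monoʳ-∣ p (p^k∣m*n∧p∤m⇒p^k∣n k pp p∤m p^k∣mr))
    where
    instance _ = prime⇒nonZero pp
    p^k∣mr : p ^ k ∣ m * r
    p^k∣mr = *-cancelˡ-∣ p (subst (p ^ suc k ∣_) (trans (sym (*-assoc m r p)) (*-comm (m * r) p)) p^k+1∣mn)

  q²∣p*e∧p∤e⇒q²∣e : ∀ {p q e} → Prime p → Prime q → p ∤ e → q * q ∣ p * e → q * q ∣ e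
  q²∣p*e∧p∤e⇒q²∣e {p} {q} {e} pp qq p∤e q²∣pe with q ≟ p
  ... | yes refl = contradiction (*-cancelˡ-∣ p q²∣pe) p∤e
    where instance _ = prime⇒nonZero pp
  ... | no q≢p = subst (_∣ e) q^2≡q*q (p^k∣m*n∧p∤m⇒p^k∣n 2 qq (q≢p ∘ prime∣prime⇒≡ pp qq) (subst (_∣ p * e) (sym q^2≡q*q) q²∣pe))
    where
    q^2≡q*q : q ^ 2 ≡ q * q
    q^2≡q*q = cong (q *_) (*-identityʳ q)

  product∣-fromPrimePowers : ∀ {ps s} → All Prime ps → (∀ {q} k → Prime q → q ^ suc k ∣ product ps → q ^ suc k ∣ s) → product ps ∣ s
  product∣-fromPrimePowers {[]} {s} [] _ = 1∣ s
  product∣-fromPrimePowers {p ∷ ps} {s} (pp ∷ pps) powers∣s with subst (_∣ s) (*-identityʳ p) (powers∣s 0 pp (*-monoʳ-∣ p (1∣ _)))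
  ... | divides s′ refl = subst (p * product ps ∣_) (*-comm p s′) (*-monoʳ-∣ p (product∣-fromPrimePowers pps powers∣s′))
    where
    instance _ = prime⇒nonZero pp
    powers∣s′ : ∀ {q} k → Prime q → q ^ suc k ∣ product ps → q ^ suc k ∣ s′
    powers∣s′ {q} k qq q^k+1∣ps with q ≟ p
    ... | yes refl = *-cancelˡ-∣ p (subst (q ^ suc (suc k) ∣_) (*-comm s′ p) (powers∣s (suc k) pp (*-monoʳ-∣ p q^k+1∣ps)))
    ... | no q≢p = p^k∣m*n∧p∤m⇒p^k∣n (suc k) qq (q≢p ∘ prime∣prime⇒≡ pp qq)
                     (subst (q ^ suc k ∣_) (*-comm s′ p) (powers∣s k qq (∣-trans q^k+1∣ps (n∣m*n p))))

  ∣-fromPrimePowers : ∀ {n s} .{{_ : NonZero n}} → (∀ {q} k → Prime q → q ^ suc k ∣ n → q ^ suc k ∣ s) → n ∣ s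
  ∣-fromPrimePowers {n} powers∣s = subst (_∣ _) (sym isFactorisation)
    (product∣-fromPrimePowers factorsPrime (λ k qq → powers∣s k qq ∘ subst (_ ∣_) (sym isFactorisation)))
    where open PrimeFactorisation (factorise n)

  prime∤! : ∀ {p} m → Prime p → m < p → p ∤ m !
  prime∤! zero pp _ p∣1 = ¬prime[1] (subst Prime (∣1⇒≡1 p∣1) pp)
  prime∤! (suc m) pp m<p p∣m! with euclidsLemma (suc m) (m !) pp p∣m!
  ... | inj₁ p∣m+1 = <⇒≱ m<p (∣⇒≤ p∣m+1)
  ... | inj₂ p∣m! = prime∤! m pp (<-trans (n<1+n m) m<p) p∣m!

  prime∣C : ∀ {p k} → Prime p → 0 < k → k < p → p ∣ p C k
  prime∣C {p@(suc p′)} {k} pp 0<k k<p with euclidsLemma (p C k) (k ! * (p ∸ k) !) pp p∣C*k!*[p∸k]!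
    where
    instance _ = k !* (p ∸ k) !≢0
    -- p! = (p C k) k! (p ∸ k)! and p divides p! but neither factorial.
    p∣C*k!*[p∸k]! : p ∣ (p C k) * (k ! * (p ∸ k) !)
    p∣C*k!*[p∸k]! = subst (p ∣_) (sym (trans (cong (_* (k ! * (p ∸ k) !)) (nCk≡n!/k![n-k]! (<⇒≤ k<p)))
                                              (m/n*n≡m (k![n∸k]!∣n! (<⇒≤ k<p)))))
                           (m∣m*n (p′ !))
  ... | inj₁ p∣C = p∣C
  ... | inj₂ p∣k!*[p∸k]! with euclidsLemma (k !) ((p ∸ k) !) pp p∣k!*[p∸k]!
  ... | inj₁ p∣k! = contradiction p∣k! (prime∤! k pp k<p)
  ... | inj₂ p∣[p∸k]! = contradiction p∣[p∸k]! (prime∤! (p ∸ k) pp (∸-monoʳ-< 0<k (<⇒≤ k<p)))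

  prime-2-or-odd : ∀ {p} → Prime p → p ≡ 2 ⊎ ∃ λ h → p ≡ suc (suc h ℕ.+ suc h)
  prime-2-or-odd {p} pp with p % 2 | m≡m%n+[m/n]*n p 2 | m%n<n p 2
  ... | 0 | p≡ | _ with prime⇒irreducible pp (divides (p / 2) p≡)
  ...   | inj₁ ()
  ...   | inj₂ 2≡p = inj₁ (sym 2≡p)
  prime-2-or-odd {p} pp | 1 | p≡ | _ with p / 2
  ...   | zero = contradiction (subst Prime p≡ pp) ¬prime[1]
  ...   | suc h = inj₂ (h , trans p≡ (cong suc (trans (*-comm (suc h) 2) (cong (suc h ℕ.+_) (+-identityʳ (suc h))))))
  prime-2-or-odd pp | suc (suc _) | _ | s≤s (s≤s ())

  +p∣a*z∧p∤a⇒+p∣z : ∀ {p} a {z} → Prime p → p ∤ ℤ.∣ a ∣ → + p ℤD.∣ a ℤ.* z → + p ℤD.∣ z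
  +p∣a*z∧p∤a⇒+p∣z {p} a {z} pp p∤a p∣az with euclidsLemma ℤ.∣ a ∣ ℤ.∣ z ∣ pp (subst (p ∣_) (ℤP.abs-* a z) (ℤD.∣⇒∣ᵤ p∣az))
  ... | inj₁ p∣a = contradiction p∣a p∤a
  ... | inj₂ p∣z = ℤD.∣ᵤ⇒∣ p∣z

  private
    odd-step : ∀ q → + 1 ℤ.+ q ℤ.* + 2 ℤ.+ + 1 ≡ (q ℤ.+ + 1) ℤ.* + 2
    odd-step = solve-∀

  even-or-odd : ∀ z → + 2 ℤD.∣ z ⊎ + 2 ℤD.∣ z ℤ.+ + 1
  even-or-odd z with z %ℕ 2 | a≡a%ℕn+[a/ℕn]*n z 2 | n%ℕd<d z 2
  ... | 0 | z≡ | _ = inj₁ (ℤD.divides (z /ℕ 2) (trans z≡ (ℤP.+-identityˡ _)))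
  ... | 1 | z≡ | _ = inj₂ (ℤD.divides (z /ℕ 2 ℤ.+ + 1) (trans (cong (λ x → x ℤ.+ + 1) z≡) (odd-step (z /ℕ 2))))
  ... | suc (suc _) | _ | s≤s (s≤s ())

module DoldCriterion where

  open import Algebra.Properties.CommutativeSemigroup as CommutativeSemigroupProperties using ()
  open import Data.Bool using (true; false)
  open import Data.Integer using (_+_; -_)
  import Data.Integer.Divisibility.Signed as ℤD
  import Data.Integer.Properties as ℤP
  open import Data.List using (List; []; _∷_; upTo; filter; map; length)
  open import Data.List.Membership.Propositional using (_∈_; _∉_)
  open import Data.List.Membership.Propositional.Properties using (∈-filter⁺; ∈-filter⁻; ∈-map⁺; ∈-map⁻; ∈-upTo⁺)
  open import Data.List.Membership.Propositional.Properties.WithK using (unique∧set⇒bag)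
  open import Data.List.Properties using (map-∘)
  open import Data.List.Relation.Binary.BagAndSetEquality using (∼bag⇒↭)
  open import Data.List.Relation.Binary.Permutation.Propositional using (_↭_; ↭⇒↭ₛ)
  open import Data.List.Relation.Binary.Permutation.Propositional.Properties using (↭-length; map⁺)
  open import Data.List.Relation.Binary.Permutation.Setoid.Properties ℤP.≡-setoid using (foldr-commMonoid)
  open import Data.List.Relation.Unary.All.Properties using (¬Any⇒All¬)
  open import Data.List.Relation.Unary.Any using (here; there)
  open import Data.List.Relation.Unary.Unique.Propositional using (Unique; _∷_)
  import Data.List.Relation.Unary.Unique.Propositional.Properties as Unique
  open import Data.Nat using (zero; _*_; _^_; NonZero)
  open import Data.Nat.DivMod using (m*n/n≡m)
  open import Data.Nat.Divisibility
  open import Data.Nat.Primality using (Prime; prime?; prime⇒nonZero)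
  open import Data.Nat.Properties using (suc-injective; *-cancelˡ-≡; *-comm; *-assoc; m*n≢0; m*n≢0⇒m≢0; m^n≢0; _≟_; *-commutativeSemigroup)
  open import Data.Product using (_×_; _,_; proj₁; proj₂; ∃)
  open import Data.Sum using (_⊎_; inj₁; inj₂)
  open import Function using (_⇔_; mk⇔; Equivalence; case_of_)
  open import Level using (0ℓ)
  open import Relation.Binary.PropositionalEquality
  open import Relation.Nullary using (¬_; contradiction; yes; no; ¬?; does)
  open import Relation.Unary using (Pred; Decidable)
  open Arithmetic using (prime∣prime⇒≡; d∣p*m∧p∤d⇒d∣m; p^k∣m*n∧p∤m⇒p^k∣n; q²∣p*e∧p∤e⇒q²∣e; ∣-fromPrimePowers)
  open CommutativeSemigroupProperties ℤP.+-commutativeSemigroup using (interchange; x∙yz≈y∙xz)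
  module ℕ* = CommutativeSemigroupProperties *-commutativeSemigroup

  unique∧set⇒↭ : ∀ {A : Set} {xs ys : List A} → Unique xs → Unique ys → (∀ {x} → x ∈ xs ⇔ x ∈ ys) → xs ↭ ys
  unique∧set⇒↭ xs! ys! same = ∼bag⇒↭ (unique∧set⇒bag xs! ys! same)

  divisors-unique : ∀ n → Unique (divisors n)
  divisors-unique n = Unique.filter⁺ _ (Unique.map⁺ suc-injective (Unique.upTo⁺ n))

  ∈-divisors : ∀ {n d} .{{_ : NonZero n}} → d ∈ divisors n ⇔ d ∣ n
  ∈-divisors {n} = mk⇔ (λ d∈ → proj₂ (∈-filter⁻ (_∣? n) {xs = map suc (upTo n)} d∈)) (λ d∣n → ∈-filter⁺ (_∣? n) (∈-range d∣n) d∣n)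
    where
    ∈-range : ∀ {d} → d ∣ n → d ∈ map suc (upTo n)
    ∈-range {zero} 0∣n = contradiction (0∣⇒≡0 0∣n) (ℕ.≢-nonZero⁻¹ n)
    ∈-range {suc d} d∣n = ∈-map⁺ suc (∈-upTo⁺ (∣⇒≤ d∣n))

  divisor-nonZero : ∀ {d n} .{{_ : NonZero n}} → d ∣ n → NonZero d
  divisor-nonZero {zero} {n} 0∣n = contradiction (0∣⇒≡0 0∣n) (ℕ.≢-nonZero⁻¹ n)
  divisor-nonZero {suc d} _ = _

  primeDivisors-unique : ∀ n → Unique (primeDivisors n)
  primeDivisors-unique n = Unique.filter⁺ prime? (divisors-unique n)

  ∈-primeDivisors : ∀ {n d} .{{_ : NonZero n}} → d ∈ primeDivisors n ⇔ (Prime d × d ∣ n)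
  ∈-primeDivisors {n} = mk⇔
    (λ d∈ → let d∈divs , pd = ∈-filter⁻ prime? {xs = divisors n} d∈ in pd , Equivalence.to ∈-divisors d∈divs)
    (λ (pd , d∣n) → ∈-filter⁺ prime? (Equivalence.from ∈-divisors d∣n) pd)

  primeDivisors-*-prime : ∀ {p e} .{{_ : NonZero e}} → Prime p → p ∤ e → primeDivisors (p * e) ↭ p ∷ primeDivisors e
  primeDivisors-*-prime {p} {e} pp p∤e =
    unique∧set⇒↭ (primeDivisors-unique (p * e)) (¬Any⇒All¬ _ p∉ ∷ primeDivisors-unique e) (mk⇔ split join)
    where
    instance
      _ = prime⇒nonZero pp
      _ = m*n≢0 p e
    open Equivalence
    p∉ : p ∉ primeDivisors e
    p∉ p∈ = p∤e (proj₂ (to (∈-primeDivisors {e}) p∈))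
    split : ∀ {d} → d ∈ primeDivisors (p * e) → d ∈ p ∷ primeDivisors e
    split {d} d∈ with to (∈-primeDivisors {p * e}) d∈ | d ≟ p
    ... | _ | yes refl = here refl
    ... | pd , d∣pe | no d≢p = there (from (∈-primeDivisors {e}) (pd , d∣p*m∧p∤d⇒d∣m pp (d≢p ∘ sym ∘ prime∣prime⇒≡ pd pp) d∣pe))
    join : ∀ {d} → d ∈ p ∷ primeDivisors e → d ∈ primeDivisors (p * e)
    join (here refl) = from (∈-primeDivisors {p * e}) (pp , m∣m*n e)
    join (there d∈) with to (∈-primeDivisors {e}) d∈
    ... | pd , d∣e = from (∈-primeDivisors {p * e}) (pd , ∣-trans d∣e (n∣m*n p))

  divisors-*-multiples : ∀ {p m} .{{_ : NonZero p}} .{{_ : NonZero m}} → filter (p ∣?_) (divisors (p * m)) ↭ map (p *_) (divisors m)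
  divisors-*-multiples {p} {m} = unique∧set⇒↭
    (Unique.filter⁺ (p ∣?_) (divisors-unique (p * m)))
    (Unique.map⁺ (*-cancelˡ-≡ _ _ p) (divisors-unique m))
    (mk⇔ factor expand)
    where
    instance _ = m*n≢0 p m
    factor : ∀ {d} → d ∈ filter (p ∣?_) (divisors (p * m)) → d ∈ map (p *_) (divisors m)
    factor d∈ with ∈-filter⁻ (p ∣?_) {xs = divisors (p * m)} d∈
    ... | d∈divs , divides e refl = subst (_∈ map (p *_) (divisors m)) (*-comm p e)
      (∈-map⁺ (p *_) (Equivalence.from (∈-divisors {m}) (*-cancelˡ-∣ p (subst (_∣ p * m) (*-comm e p) (Equivalence.to (∈-divisors {p * m}) d∈divs)))))
    expand : ∀ {d} → d ∈ map (p *_) (divisors m) → d ∈ filter (p ∣?_) (divisors (p * m))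
    expand d∈ with ∈-map⁻ (p *_) d∈
    ... | e , e∈ , refl = ∈-filter⁺ (p ∣?_) (Equivalence.from (∈-divisors {p * m}) (*-monoʳ-∣ p (Equivalence.to (∈-divisors {m}) e∈))) (m∣m*n e)

  coprimeDivisors-*-prime : ∀ {p m} .{{_ : NonZero m}} → Prime p →
    filter (λ d → ¬? (p ∣? d)) (divisors (p * m)) ↭ filter (λ d → ¬? (p ∣? d)) (divisors m)
  coprimeDivisors-*-prime {p} {m} pp = unique∧set⇒↭
    (Unique.filter⁺ _ (divisors-unique (p * m)))
    (Unique.filter⁺ _ (divisors-unique m))
    (mk⇔ shrink grow)
    where
    instance _ = m*n≢0 p m {{prime⇒nonZero pp}}
    shrink : ∀ {d} → d ∈ filter (λ d → ¬? (p ∣? d)) (divisors (p * m)) → d ∈ filter (λ d → ¬? (p ∣? d)) (divisors m)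
    shrink d∈ with ∈-filter⁻ (λ d → ¬? (p ∣? d)) {xs = divisors (p * m)} d∈
    ... | d∈divs , p∤d =
      ∈-filter⁺ _ (Equivalence.from (∈-divisors {m}) (d∣p*m∧p∤d⇒d∣m pp p∤d (Equivalence.to (∈-divisors {p * m}) d∈divs))) p∤d
    grow : ∀ {d} → d ∈ filter (λ d → ¬? (p ∣? d)) (divisors m) → d ∈ filter (λ d → ¬? (p ∣? d)) (divisors (p * m))
    grow d∈ with ∈-filter⁻ (λ d → ¬? (p ∣? d)) {xs = divisors m} d∈
    ... | d∈divs , p∤d = ∈-filter⁺ _ (Equivalence.from (∈-divisors {p * m}) (∣-trans (Equivalence.to (∈-divisors {m}) d∈divs) (n∣m*n p))) p∤d

  -- The list whose length Defs.μ inspects, so that `μ n` reduces once it is known.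
  squarePrimeDivisors : ℕ → List ℕ
  squarePrimeDivisors n = filter (λ p → (p * p) ∣? n) (primeDivisors n)

  ∈-squarePrimeDivisors : ∀ {n q} .{{_ : NonZero n}} → q ∈ squarePrimeDivisors n ⇔ (Prime q × q * q ∣ n)
  ∈-squarePrimeDivisors {n} = mk⇔
    (λ q∈ → let q∈pd , q²∣n = ∈-filter⁻ (λ p → (p * p) ∣? n) {xs = primeDivisors n} q∈
            in proj₁ (Equivalence.to (∈-primeDivisors {n}) q∈pd) , q²∣n)
    (λ (qq , q²∣n) → ∈-filter⁺ (λ p → (p * p) ∣? n) (Equivalence.from (∈-primeDivisors {n}) (qq , ∣-trans (m∣m*n _) q²∣n)) q²∣n)

  squarePrimeDivisor : ∀ {n q qs} .{{_ : NonZero n}} → squarePrimeDivisors n ≡ q ∷ qs → Prime q × q * q ∣ n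
  squarePrimeDivisor {n} {q} eq = Equivalence.to (∈-squarePrimeDivisors {n}) (subst (q ∈_) (sym eq) (here refl))

  squarefree? : ∀ n .{{_ : NonZero n}} → (∃ λ q → Prime q × q * q ∣ n) ⊎ (∀ {q} → Prime q → ¬ q * q ∣ n)
  squarefree? n with squarePrimeDivisors n in eq
  ... | q ∷ _ = inj₁ (q , squarePrimeDivisor eq)
  ... | [] = inj₂ (λ qq q²∣n → case subst (_ ∈_) eq (Equivalence.from (∈-squarePrimeDivisors {n}) (qq , q²∣n)) of λ ())

  μ≡0 : ∀ {n q} .{{_ : NonZero n}} → Prime q → q * q ∣ n → μ n ≡ + 0
  μ≡0 {n} qq q²∣n with squarePrimeDivisors n | Equivalence.from (∈-squarePrimeDivisors {n}) (qq , q²∣n)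
  ... | _ ∷ _ | _ = refl

  μ≡signPow : ∀ {n} .{{_ : NonZero n}} → (∀ {q} → Prime q → ¬ q * q ∣ n) → μ n ≡ signPow (length (primeDivisors n))
  μ≡signPow {n} squarefree with squarePrimeDivisors n in eq
  ... | [] = refl
  ... | q ∷ _ = let qq , q²∣n = squarePrimeDivisor eq in contradiction q²∣n (squarefree qq)

  μ-*-prime : ∀ {p e} .{{_ : NonZero e}} → Prime p → p ∤ e → μ (p * e) ≡ - μ e
  μ-*-prime {p} {e} pp p∤e with squarefree? e
  ... | inj₁ (q , qq , q²∣e) = trans (μ≡0 qq (∣-trans q²∣e (n∣m*n p))) (cong -_ (sym (μ≡0 qq q²∣e)))
    where instance _ = m*n≢0 p e {{prime⇒nonZero pp}}
  ... | inj₂ e-squarefree = begin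
    μ (p * e)                                ≡⟨ μ≡signPow (λ qq q²∣pe → e-squarefree qq (q²∣p*e∧p∤e⇒q²∣e pp qq p∤e q²∣pe)) ⟩
    signPow (length (primeDivisors (p * e))) ≡⟨ cong signPow (↭-length (primeDivisors-*-prime pp p∤e)) ⟩
    - signPow (length (primeDivisors e))     ≡⟨ cong -_ (sym (μ≡signPow e-squarefree)) ⟩
    - μ e                                    ∎
    where
    open ≡-Reasoning
    instance _ = m*n≢0 p e {{prime⇒nonZero pp}}

  sumℤ-↭ : ∀ {xs ys} → xs ↭ ys → sumℤ xs ≡ sumℤ ys
  sumℤ-↭ xs↭ys = foldr-commMonoid ℤP.+-0-isCommutativeMonoid (↭⇒↭ₛ xs↭ys)

  sumℤ-partition : ∀ {A : Set} {P : Pred A 0ℓ} (P? : Decidable P) (f : A → ℤ) xs →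
    sumℤ (map f xs) ≡ sumℤ (map f (filter P? xs)) + sumℤ (map f (filter (¬? ∘ P?) xs))
  sumℤ-partition P? f [] = refl
  sumℤ-partition P? f (x ∷ xs) with does (P? x)
  ... | true = trans (cong (λ s → f x + s) (sumℤ-partition P? f xs)) (sym (ℤP.+-assoc (f x) _ _))
  ... | false = trans (cong (λ s → f x + s) (sumℤ-partition P? f xs)) (x∙yz≈y∙xz (f x) (sumℤ (map f (filter P? xs))) _)

  sumℤ-map-cong : ∀ {A : Set} {f g : A → ℤ} xs → (∀ {x} → x ∈ xs → f x ≡ g x) → sumℤ (map f xs) ≡ sumℤ (map g xs)
  sumℤ-map-cong [] _ = refl
  sumℤ-map-cong (x ∷ xs) f≗g = cong₂ _+_ (f≗g (here refl)) (sumℤ-map-cong xs (f≗g ∘ there))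

  sumℤ-map-zero : ∀ {A : Set} (xs : List A) → sumℤ (map (λ _ → + 0) xs) ≡ + 0
  sumℤ-map-zero [] = refl
  sumℤ-map-zero (x ∷ xs) = trans (ℤP.+-identityˡ _) (sumℤ-map-zero xs)

  sumℤ-map-+ : ∀ {A : Set} (f g : A → ℤ) xs → sumℤ (map f xs) + sumℤ (map g xs) ≡ sumℤ (map (λ x → f x + g x) xs)
  sumℤ-map-+ f g [] = refl
  sumℤ-map-+ f g (x ∷ xs) = trans (interchange (f x) _ (g x) _) (cong (λ s → f x + g x + s) (sumℤ-map-+ f g xs))

  ∣-sumℤ : ∀ {A : Set} {k : ℤ} {f : A → ℤ} xs → (∀ {x} → x ∈ xs → k ℤD.∣ f x) → k ℤD.∣ sumℤ (map f xs)
  ∣-sumℤ [] _ = ℤD.divides (+ 0) refl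
  ∣-sumℤ (x ∷ xs) k∣f = ℤD.∣m∣n⇒∣m+n (k∣f (here refl)) (∣-sumℤ xs (k∣f ∘ there))

  div-* : ∀ q d .{{_ : NonZero d}} → div (q * d) d ≡ q
  div-* q (suc d) = m*n/n≡m q (suc d)

  divisorTerm : (ℕ → ℤ) → ℕ → ℕ → ℤ
  divisorTerm B n d = μ d ℤ.* B (div n d)

  module _ (B : ℕ → ℤ) {p m} .{{_ : NonZero m}} (pp : Prime p) where

    private
      instance
        _ = prime⇒nonZero pp
        _ = m*n≢0 p m
      p∤_ = λ d → ¬? (p ∣? d)
      T = divisorTerm B (p * m)
      S = divisorTerm B m

    divisorTerm-*-multiple : ∀ {e} → e ∈ divisors m → p ∣ e → T (p * e) ≡ + 0
    divisorTerm-*-multiple {e} e∈ p∣e = cong (ℤ._* B (div (p * m) (p * e))) (μ≡0 pp (*-monoʳ-∣ p p∣e))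
      where
      instance
        _ = divisor-nonZero (Equivalence.to (∈-divisors {m}) e∈)
        _ = m*n≢0 p e

    divisorTerm-*-coprime : ∀ {e} → e ∈ divisors m → p ∤ e → T (p * e) ≡ - S e
    divisorTerm-*-coprime {e} e∈ p∤e with Equivalence.to (∈-divisors {m}) e∈
    ... | divides q refl = begin
      μ (p * e) ℤ.* B (div (p * (q * e)) (p * e))
        ≡⟨ cong₂ (λ u v → u ℤ.* B v) (μ-*-prime pp p∤e) (trans (cong (λ n → div n (p * e)) (ℕ*.x∙yz≈y∙xz p q e)) (div-* q (p * e))) ⟩
      - μ e ℤ.* B q                               ≡⟨ sym (ℤP.neg-distribˡ-* (μ e) (B q)) ⟩
      - (μ e ℤ.* B q)                             ≡⟨ cong (λ v → - (μ e ℤ.* B v)) (sym (div-* q e)) ⟩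
      - S e                                       ∎
      where
      open ≡-Reasoning
      instance
        _ = divisor-nonZero (Equivalence.to (∈-divisors {m}) e∈)
        _ = m*n≢0 p e

    -- The divisors of p m divisible by p are the p e with e ∣ m, and μ (p e) is 0 if p ∣ e and
    -- − μ e otherwise.
    doldSum-*-prime : doldSum B (p * m) ≡ sumℤ (map (λ d → T d ℤ.- S d) (filter p∤_ (divisors m)))
    doldSum-*-prime = begin
      sumℤ (map T (divisors (p * m)))
        ≡⟨ sumℤ-partition (p ∣?_) T (divisors (p * m)) ⟩
      sumℤ (map T (filter (p ∣?_) (divisors (p * m)))) + sumℤ (map T (filter p∤_ (divisors (p * m))))
        ≡⟨ cong₂ _+_ (sumℤ-↭ (map⁺ T (divisors-*-multiples {p} {m}))) (sumℤ-↭ (map⁺ T (coprimeDivisors-*-prime pp))) ⟩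
      sumℤ (map T (map (p *_) (divisors m))) + ΣT
        ≡⟨ cong (λ s → sumℤ s + ΣT) (sym (map-∘ (divisors m))) ⟩
      sumℤ (map (T ∘ (p *_)) (divisors m)) + ΣT
        ≡⟨ cong (_+ ΣT) (sumℤ-partition (p ∣?_) (T ∘ (p *_)) (divisors m)) ⟩
      sumℤ (map (T ∘ (p *_)) (filter (p ∣?_) (divisors m))) + sumℤ (map (T ∘ (p *_)) D) + ΣT
        ≡⟨ cong₂ (λ s t → s + t + ΣT) (sumℤ-map-cong _ multiple) (sumℤ-map-cong D coprime) ⟩
      sumℤ (map (λ _ → + 0) (filter (p ∣?_) (divisors m))) + Σ-S + ΣT
        ≡⟨ cong (λ s → s + Σ-S + ΣT) (sumℤ-map-zero (filter (p ∣?_) (divisors m))) ⟩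
      + 0 + Σ-S + ΣT
        ≡⟨ trans (cong (_+ ΣT) (ℤP.+-identityˡ Σ-S)) (ℤP.+-comm Σ-S ΣT) ⟩
      ΣT + Σ-S
        ≡⟨ sumℤ-map-+ T (-_ ∘ S) D ⟩
      sumℤ (map (λ d → T d ℤ.- S d) D) ∎
      where
      open ≡-Reasoning
      D = filter p∤_ (divisors m)
      ΣT = sumℤ (map T D)
      Σ-S = sumℤ (map (-_ ∘ S) D)
      multiple : ∀ {e} → e ∈ filter (p ∣?_) (divisors m) → T (p * e) ≡ + 0
      multiple e∈ = let e∈divs , p∣e = ∈-filter⁻ (p ∣?_) {xs = divisors m} e∈ in divisorTerm-*-multiple e∈divs p∣e
      coprime : ∀ {e} → e ∈ D → T (p * e) ≡ - S e
      coprime e∈ = let e∈divs , p∤e = ∈-filter⁻ p∤_ {xs = divisors m} e∈ in divisorTerm-*-coprime e∈divs p∤e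

  EulerCongruences : (ℕ → ℤ) → Set
  EulerCongruences B = ∀ {p} k m → Prime p → p ^ k ∣ m → + (p ^ suc k) ℤD.∣ B (p * m) ℤ.- B m

  module _ {B : ℕ → ℤ} (euler : EulerCongruences B) where

    primePower∣doldSum : ∀ {p} k m .{{_ : NonZero m}} → Prime p → p ^ k ∣ m → + (p ^ suc k) ℤD.∣ doldSum B (p * m)
    primePower∣doldSum {p} k m pp p^k∣m = subst (+ (p ^ suc k) ℤD.∣_) (sym (doldSum-*-prime B pp))
      (∣-sumℤ (filter (λ d → ¬? (p ∣? d)) (divisors m)) term∣)
      where
      term∣ : ∀ {d} → d ∈ filter (λ d → ¬? (p ∣? d)) (divisors m) → + (p ^ suc k) ℤD.∣ divisorTerm B (p * m) d ℤ.- divisorTerm B m d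
      term∣ {d} d∈ with ∈-filter⁻ (λ d → ¬? (p ∣? d)) {xs = divisors m} d∈
      ... | d∈divs , p∤d with Equivalence.to (∈-divisors {m}) d∈divs
      ... | divides q refl = subst (+ (p ^ suc k) ℤD.∣_) (sym factor) (ℤD.∣n⇒∣m*n (μ d) (euler k q pp p^k∣q))
        where
        instance _ = divisor-nonZero (Equivalence.to (∈-divisors {m}) d∈divs)
        p^k∣q : p ^ k ∣ q
        p^k∣q = p^k∣m*n∧p∤m⇒p^k∣n k pp p∤d (subst (p ^ k ∣_) (*-comm q d) p^k∣m)
        factor : μ d ℤ.* B (div (p * (q * d)) d) ℤ.- μ d ℤ.* B (div (q * d) d) ≡ μ d ℤ.* (B (p * q) ℤ.- B q)
        factor = begin
          μ d ℤ.* B (div (p * (q * d)) d) ℤ.- μ d ℤ.* B (div (q * d) d)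
            ≡⟨ cong₂ (λ u v → μ d ℤ.* B u ℤ.- μ d ℤ.* B v) (trans (cong (λ n → div n d) (sym (*-assoc p q d))) (div-* (p * q) d)) (div-* q d) ⟩
          μ d ℤ.* B (p * q) ℤ.- μ d ℤ.* B q
            ≡⟨ cong (λ t → μ d ℤ.* B (p * q) + t) (ℤP.neg-distribʳ-* (μ d) (B q)) ⟩
          μ d ℤ.* B (p * q) + μ d ℤ.* (- B q)
            ≡⟨ sym (ℤP.*-distribˡ-+ (μ d) (B (p * q)) (- B q)) ⟩
          μ d ℤ.* (B (p * q) ℤ.- B q) ∎
          where open ≡-Reasoning

    euler⇒dold : Dold B
    euler⇒dold n 1≤n = ∣-fromPrimePowers {{ℕ.>-nonZero 1≤n}} primePower∣
      where
      primePower∣ : ∀ {p} k → Prime p → p ^ suc k ∣ n → p ^ suc k ∣ ℤ.∣ doldSum B n ∣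
      primePower∣ {p} k pp (divides r refl) = ℤD.∣⇒∣ᵤ (subst (λ n → + (p ^ suc k) ℤD.∣ doldSum B n) (ℕ*.x∙yz≈y∙xz p r (p ^ k))
                                                        (primePower∣doldSum k (r * p ^ k) pp (n∣m*n r)))
        where
        instance
          _ = m*n≢0⇒m≢0 r {{ℕ.>-nonZero 1≤n}}
          _ = m^n≢0 p k {{prime⇒nonZero pp}}
          _ = m*n≢0 r (p ^ k)

module Congruence {c ℓ} (R : CommutativeRing c ℓ) where

  open CommutativeRing R hiding (zero)
  open import Algebra.Definitions.RawMagma *-rawMagma using (_∣_; _,_)
  open import Algebra.Properties.CommutativeSemiring.Exp commutativeSemiring using (_^_; ^-congˡ; ^-congʳ; ^-assocʳ; ^-homo-*)
  import Algebra.Properties.CommutativeSemiring.Binomial commutativeSemiring as Binomial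
  open import Algebra.Properties.Monoid.Sum +-monoid using (sum; sum-init-last)
  open import Algebra.Properties.Ring ring using (-1*x≈-x)
  open import Algebra.Properties.Semiring.Mult semiring using (_×_; ×-assoc-*; ×-congʳ; ×-congˡ; ×-cong; ×1-homo-*)
  open import Algebra.Solver.Ring.NaturalCoefficients.Default commutativeSemiring
  open import Data.Fin using (zero; suc; toℕ; inject₁; fromℕ)
  open import Data.Fin.Properties using (toℕ-inject₁; toℕ-fromℕ; toℕ≤pred[n])
  open import Data.Nat using (zero; suc; s≤s; z≤n; _∸_)
  import Data.Nat.Properties as ℕP
  open import Data.Nat.Combinatorics using (_C_; nCn≡1)
  open import Data.Nat.Divisibility using (divides)
  open import Data.Nat.Primality using (Prime; prime⇒nonZero)
  open import Data.Product using (∃; _,_)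
  open import Data.Vec.Functional using (Vector; init)
  open import Level using (_⊔_)
  import Relation.Binary.PropositionalEquality as ≡
  open import Relation.Binary.Bundles using (Preorder)
  open import Relation.Binary.Structures using (IsPreorder)
  import Relation.Binary.Reasoning.Preorder as PreorderReasoning
  import Relation.Binary.Reasoning.Setoid as SetoidReasoning
  open Arithmetic using (prime∣C)

  module ≈-Reasoning = SetoidReasoning setoid

  ⟨_⟩ : ℕ → Carrier
  ⟨ n ⟩ = n × 1#

  infix 4 _≡_[mod_]
  _≡_[mod_] : Carrier → Carrier → Carrier → Set (c ⊔ ℓ)
  x ≡ y [mod m ] = ∃ λ w → x ≈ y + m * w

  module _ {m : Carrier} where

    ≈⇒≡mod : ∀ {x y} → x ≈ y → x ≡ y [mod m ]
    ≈⇒≡mod {x} {y} x≈y = 0# , (begin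
      x           ≈⟨ x≈y ⟩
      y           ≈⟨ solve 2 (λ y m → y := y :+ m :* con 0) refl y m ⟩
      y + m * 0# ∎)
      where open ≈-Reasoning

    mod-trans : ∀ {x y z} → x ≡ y [mod m ] → y ≡ z [mod m ] → x ≡ z [mod m ]
    mod-trans {x} {y} {z} (w , x≈y+mw) (v , y≈z+mv) = v + w , (begin
      x                   ≈⟨ x≈y+mw ⟩
      y + m * w           ≈⟨ +-congʳ y≈z+mv ⟩
      z + m * v + m * w   ≈⟨ solve 4 (λ z m v w → z :+ m :* v :+ m :* w := z :+ m :* (v :+ w)) refl z m v w ⟩
      z + m * (v + w)     ∎)
      where open ≈-Reasoning

    mod-sym : ∀ {x y} → x ≡ y [mod m ] → y ≡ x [mod m ]
    mod-sym {x} {y} (w , x≈y+mw) = - w , (begin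
      y                        ≈⟨ solve 2 (λ y m → y := y :+ m :* con 0) refl y m ⟩
      y + m * 0#               ≈⟨ +-congˡ (*-congˡ (sym (-‿inverseʳ w))) ⟩
      y + m * (w - w)          ≈⟨ solve 4 (λ y m w v → y :+ m :* (w :+ v) := y :+ m :* w :+ m :* v) refl y m w (- w) ⟩
      y + m * w + m * - w      ≈⟨ +-congʳ (sym x≈y+mw) ⟩
      x + m * - w              ∎)
      where open ≈-Reasoning

    mod-isPreorder : IsPreorder _≈_ _≡_[mod m ]
    mod-isPreorder = record { isEquivalence = isEquivalence ; reflexive = ≈⇒≡mod ; trans = mod-trans }

    mod-+ : ∀ {x y u v} → x ≡ y [mod m ] → u ≡ v [mod m ] → x + u ≡ y + v [mod m ]
    mod-+ {x} {y} {u} {v} (w , x≈y+mw) (w′ , u≈v+mw′) = w + w′ , (begin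
      x + u                         ≈⟨ +-cong x≈y+mw u≈v+mw′ ⟩
      y + m * w + (v + m * w′)      ≈⟨ solve 5 (λ y v m w w′ → y :+ m :* w :+ (v :+ m :* w′) := y :+ v :+ m :* (w :+ w′)) refl y v m w w′ ⟩
      y + v + m * (w + w′)          ∎)
      where open ≈-Reasoning

    mod-*ˡ : ∀ z {x y} → x ≡ y [mod m ] → z * x ≡ z * y [mod m ]
    mod-*ˡ z {x} {y} (w , x≈y+mw) = z * w , (begin
      z * x             ≈⟨ *-congˡ x≈y+mw ⟩
      z * (y + m * w)   ≈⟨ solve 4 (λ z y m w → z :* (y :+ m :* w) := z :* y :+ m :* (z :* w)) refl z y m w ⟩
      z * y + m * (z * w) ∎)
      where open ≈-Reasoning

    mod-*ʳ : ∀ z {x y} → x ≡ y [mod m ] → x * z ≡ y * z [mod m ]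
    mod-*ʳ z {x} {y} x≡y = mod-trans (≈⇒≡mod (*-comm x z)) (mod-trans (mod-*ˡ z x≡y) (≈⇒≡mod (*-comm z y)))

    mod-+ˡ : ∀ z {x y} → x ≡ y [mod m ] → z + x ≡ z + y [mod m ]
    mod-+ˡ z = mod-+ (≈⇒≡mod refl)

    mod-* : ∀ {x y u v} → x ≡ y [mod m ] → u ≡ v [mod m ] → x * u ≡ y * v [mod m ]
    mod-* {x} {y} {u} {v} x≡y u≡v = mod-trans (mod-*ʳ u x≡y) (mod-*ˡ y u≡v)

    mod-neg : ∀ {x y} → x ≡ y [mod m ] → - x ≡ - y [mod m ]
    mod-neg {x} {y} x≡y = mod-trans (≈⇒≡mod (sym (-1*x≈-x x))) (mod-trans (mod-*ˡ (- 1#) x≡y) (≈⇒≡mod (-1*x≈-x y)))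

    mod-^ : ∀ {x y} → x ≡ y [mod m ] → ∀ n → x ^ n ≡ y ^ n [mod m ]
    mod-^ x≡y zero = ≈⇒≡mod refl
    mod-^ x≡y (suc n) = mod-* x≡y (mod-^ x≡y n)

  mod-preorder : Carrier → Preorder c ℓ (c ⊔ ℓ)
  mod-preorder m = record { isPreorder = mod-isPreorder {m} }

  module ≡-mod-Reasoning (m : Carrier) = PreorderReasoning (mod-preorder m)

  mod-∣ : ∀ {m m′ x y} → m ∣ m′ → x ≡ y [mod m′ ] → x ≡ y [mod m ]
  mod-∣ {m} {m′} {x} {y} (q , qm≈m′) (w , x≈y+m′w) = q * w , (begin
    x               ≈⟨ x≈y+m′w ⟩
    y + m′ * w      ≈⟨ +-congˡ (*-congʳ (sym qm≈m′)) ⟩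
    y + q * m * w   ≈⟨ solve 4 (λ y q m w → y :+ q :* m :* w := y :+ m :* (q :* w)) refl y q m w ⟩
    y + m * (q * w) ∎)
    where open ≈-Reasoning

  mod-scale : ∀ {m x y} a → x ≡ y [mod m ] → a * x ≡ a * y [mod a * m ]
  mod-scale {m} {x} {y} a (w , x≈y+mw) = w , (begin
    a * x             ≈⟨ *-congˡ x≈y+mw ⟩
    a * (y + m * w)   ≈⟨ solve 4 (λ a y m w → a :* (y :+ m :* w) := a :* y :+ a :* m :* w) refl a y m w ⟩
    a * y + a * m * w ∎)
    where open ≈-Reasoning

  multiple≡0 : ∀ m w → m * w ≡ 0# [mod m ]
  multiple≡0 m w = w , solve 2 (λ m w → m :* w := con 0 :+ m :* w) refl m w

  mod-one : ∀ x y → x ≡ y [mod 1# ]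
  mod-one x y = x - y , (begin
    x                  ≈⟨ sym (+-identityˡ x) ⟩
    0# + x             ≈⟨ +-congʳ (sym (-‿inverseʳ y)) ⟩
    y - y + x          ≈⟨ +-assoc y (- y) x ⟩
    y + (- y + x)      ≈⟨ +-congˡ (+-comm (- y) x) ⟩
    y + (x - y)        ≈⟨ +-congˡ (sym (*-identityˡ (x - y))) ⟩
    y + 1# * (x - y)   ∎)
    where open ≈-Reasoning

  ^-∣ : ∀ x {i j} → i ℕ.≤ j → x ^ i ∣ x ^ j
  ^-∣ x {i} i≤j with ℕP.m≤n⇒∃[o]m+o≡n i≤j
  ... | d , i+d≡j = x ^ d , trans (*-comm (x ^ d) (x ^ i)) (trans (sym (^-homo-* x i d)) (^-congʳ x i+d≡j))

  ∣-*ʳ : ∀ m a → m ∣ m * a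
  ∣-*ʳ m a = a , *-comm a m

  n×x≈⟨n⟩*x : ∀ n x → n × x ≈ ⟨ n ⟩ * x
  n×x≈⟨n⟩*x n x = sym (trans (×-assoc-* n 1# x) (×-congʳ n (*-identityˡ x)))

  1^n≈1 : ∀ n → 1# ^ n ≈ 1#
  1^n≈1 zero = refl
  1^n≈1 (suc n) = trans (*-identityˡ (1# ^ n)) (1^n≈1 n)

  0^n≈0 : ∀ n .{{_ : ℕ.NonZero n}} → 0# ^ n ≈ 0#
  0^n≈0 (suc n) = zeroˡ (0# ^ n)

  mod-sum : ∀ {m n} (f : Vector Carrier n) → (∀ i → f i ≡ 0# [mod m ]) → sum f ≡ 0# [mod m ]
  mod-sum {n = zero} f _ = ≈⇒≡mod refl
  mod-sum {n = suc n} f f≡0 = mod-trans (mod-+ (f≡0 zero) (mod-sum (f ∘ suc) (f≡0 ∘ suc))) (≈⇒≡mod (+-identityˡ 0#))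

  binomialTerm≡0 : ∀ {p} → Prime p → ∀ x k z → suc k ℕ.< p → (p C suc k) × (x ^ suc k * z) ≡ 0# [mod ⟨ p ⟩ * x ]
  binomialTerm≡0 {p} pp x k z k+1<p with prime∣C pp (s≤s z≤n) k+1<p
  ... | divides c pCk≡cp = mod-trans (≈⇒≡mod (begin
    (p C suc k) × (x * x ^ k * z)     ≈⟨ n×x≈⟨n⟩*x (p C suc k) _ ⟩
    ⟨ p C suc k ⟩ * (x * x ^ k * z)   ≈⟨ *-congʳ (trans (×-congˡ pCk≡cp) (×1-homo-* c p)) ⟩
    ⟨ c ⟩ * ⟨ p ⟩ * (x * x ^ k * z)   ≈⟨ solve 5 (λ c P x X z → c :* P :* (x :* X :* z) := P :* x :* (c :* (X :* z))) refl ⟨ c ⟩ ⟨ p ⟩ x (x ^ k) z ⟩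
    ⟨ p ⟩ * x * (⟨ c ⟩ * (x ^ k * z)) ∎)) (multiple≡0 (⟨ p ⟩ * x) _)
    where open ≈-Reasoning

  frobenius : ∀ {p} → Prime p → ∀ x y → (x + y) ^ p ≡ x ^ p + y ^ p [mod ⟨ p ⟩ * x ]
  frobenius {p@(suc (suc q))} pp x y = begin
    (x + y) ^ p                                   ≈⟨ Binomial.theorem p x y ⟩
    t zero + sum (t ∘ suc)                        ≈⟨ +-congˡ (sum-init-last (t ∘ suc)) ⟩
    t zero + (sum (init (t ∘ suc)) + t (fromℕ p)) ∼⟨ mod-+ (≈⇒≡mod first) (mod-+ (mod-sum _ middle) (≈⇒≡mod (final _ (toℕ-fromℕ p)))) ⟩
    y ^ p + (0# + x ^ p)                          ≈⟨ solve 2 (λ X Y → Y :+ (con 0 :+ X) := X :+ Y) refl (x ^ p) (y ^ p) ⟩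
    x ^ p + y ^ p                                 ∎
    where
    open ≡-mod-Reasoning (⟨ p ⟩ * x)
    t = Binomial.binomialTerm x y p
    first : t zero ≈ y ^ p
    first = trans (+-identityʳ _) (*-identityˡ (y ^ p))
    middle : ∀ i → init (t ∘ suc) i ≡ 0# [mod ⟨ p ⟩ * x ]
    middle i = binomialTerm≡0 pp x (toℕ (inject₁ i)) _ (s≤s (s≤s (≡.subst (ℕ._≤ q) (≡.sym (toℕ-inject₁ i)) (toℕ≤pred[n] i))))
    final : ∀ k → k ≡ p → (p C k) × (x ^ k * y ^ (p ∸ k)) ≈ x ^ p
    final .p ≡.refl = begin-equality
      (p C p) × (x ^ p * y ^ (p ∸ p)) ≈⟨ ×-cong (nCn≡1 p) (*-congˡ (^-congʳ y (ℕP.n∸n≡0 p))) ⟩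
      1 × (x ^ p * 1#)                ≈⟨ trans (+-identityʳ _) (*-identityʳ (x ^ p)) ⟩
      x ^ p                           ∎

  module _ {p} (pp : Prime p) where

    private
      P = ⟨ p ⟩
      instance _ = prime⇒nonZero pp

    frobenius-mod-p : ∀ x y → (x + y) ^ p ≡ x ^ p + y ^ p [mod P ]
    frobenius-mod-p x y = mod-∣ (∣-*ʳ P x) (frobenius pp x y)

    fermat : ∀ n → ⟨ n ⟩ ^ p ≡ ⟨ n ⟩ [mod P ]
    fermat zero = ≈⇒≡mod (0^n≈0 p)
    fermat (suc n) = begin
      (1# + ⟨ n ⟩) ^ p      ∼⟨ frobenius-mod-p 1# ⟨ n ⟩ ⟩
      1# ^ p + ⟨ n ⟩ ^ p  ∼⟨ mod-+ (≈⇒≡mod (1^n≈1 p)) (fermat n) ⟩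
      1# + ⟨ n ⟩            ∎
      where open ≡-mod-Reasoning P

    -‿^-prime : ∀ x → (- x) ^ p ≡ - (x ^ p) [mod P ]
    -‿^-prime x = begin
      (- x) ^ p                          ≈⟨ sym (trans (sym (+-assoc _ _ _)) (trans (+-congʳ (-‿inverseˡ (x ^ p))) (+-identityˡ _))) ⟩
      - (x ^ p) + (x ^ p + (- x) ^ p)    ∼⟨ mod-+ (≈⇒≡mod refl) (mod-sym (frobenius-mod-p x (- x))) ⟩
      - (x ^ p) + (x - x) ^ p            ≈⟨ +-congˡ (trans (^-congˡ p (-‿inverseʳ x)) (0^n≈0 p)) ⟩
      - (x ^ p) + 0#                     ≈⟨ +-identityʳ _ ⟩
      - (x ^ p)                          ∎
      where open ≡-mod-Reasoning P

  -- By Frobenius (m w + y)^p ≡ y^p + (m w)^p modulo p m w, and p m divides m² and hence (m w)^p.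
  mod-lift : ∀ {p} → Prime p → ∀ {m x y} → ⟨ p ⟩ ∣ m → x ≡ y [mod m ] → x ^ p ≡ y ^ p [mod ⟨ p ⟩ * m ]
  mod-lift {p@(suc (suc q))} pp {m} {x} {y} (r , rP≈m) (w , x≈y+mw) = begin
    x ^ p                 ≈⟨ ^-congˡ p (trans x≈y+mw (+-comm y (m * w))) ⟩
    (m * w + y) ^ p       ∼⟨ mod-∣ (w , solve 3 (λ w P m → w :* (P :* m) := P :* (m :* w)) refl w P m) (frobenius pp (m * w) y) ⟩
    (m * w) ^ p + y ^ p   ∼⟨ mod-+ (mod-trans (≈⇒≡mod [mw]^p≈) (multiple≡0 (P * m) _)) (≈⇒≡mod refl) ⟩
    0# + y ^ p            ≈⟨ +-identityˡ (y ^ p) ⟩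
    y ^ p                 ∎
    where
    open ≡-mod-Reasoning (⟨ p ⟩ * m)
    P = ⟨ p ⟩
    [mw]^p≈ : (m * w) ^ p ≈ P * m * (r * (w * (w * (m * w) ^ q)))
    [mw]^p≈ = begin-equality
      m * w * (m * w * (m * w) ^ q)      ≈⟨ *-congʳ (*-congʳ (sym rP≈m)) ⟩
      r * P * w * (m * w * (m * w) ^ q)  ≈⟨ solve 5 (λ r P w m Z → r :* P :* w :* (m :* w :* Z) := P :* m :* (r :* (w :* (w :* Z)))) refl r P w m ((m * w) ^ q) ⟩
      P * m * (r * (w * (w * (m * w) ^ q))) ∎

  mod-lift^ : ∀ {p} → Prime p → ∀ {x y} → x ≡ y [mod ⟨ p ⟩ ] → ∀ j → x ^ (p ℕ.^ j) ≡ y ^ (p ℕ.^ j) [mod ⟨ p ⟩ ^ suc j ]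
  mod-lift^ {p} pp {x} {y} x≡y zero = mod-∣ (1# , trans (*-identityˡ _) (*-identityʳ ⟨ p ⟩)) (mod-* x≡y (≈⇒≡mod refl))
  mod-lift^ {p} pp {x} {y} x≡y (suc j) = begin
    x ^ (p ℕ.* p ℕ.^ j)     ≈⟨ x^[p*n]≈[x^n]^p x ⟩
    (x ^ (p ℕ.^ j)) ^ p     ∼⟨ mod-lift pp ((⟨ p ⟩ ^ j) , *-comm _ _) (mod-lift^ pp x≡y j) ⟩
    (y ^ (p ℕ.^ j)) ^ p     ≈⟨ sym (x^[p*n]≈[x^n]^p y) ⟩
    y ^ (p ℕ.* p ℕ.^ j)     ∎
    where
    open ≡-mod-Reasoning (⟨ p ⟩ ^ suc (suc j))
    x^[p*n]≈[x^n]^p : ∀ x → x ^ (p ℕ.* p ℕ.^ j) ≈ (x ^ (p ℕ.^ j)) ^ p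
    x^[p*n]≈[x^n]^p x = trans (^-congʳ x (ℕP.*-comm p (p ℕ.^ j))) (sym (^-assocʳ x (p ℕ.^ j) p))

  frobeniusFixed⇒mod-lift : ∀ {p} → Prime p → ∀ {x} → x ^ (p ℕ.* p) ≡ x ^ p [mod ⟨ p ⟩ ] →
                            ∀ j → x ^ (p ℕ.^ suc j) ≡ x ^ (p ℕ.^ j) [mod ⟨ p ⟩ ^ j ]
  frobeniusFixed⇒mod-lift pp {x} _ zero = mod-one _ _
  frobeniusFixed⇒mod-lift {p} pp {x} x^p²≡x^p (suc j) = begin
    x ^ (p ℕ.* (p ℕ.* p ℕ.^ j))   ≈⟨ ^-congʳ x (≡.sym (ℕP.*-assoc p p (p ℕ.^ j))) ⟩
    x ^ (p ℕ.* p ℕ.* p ℕ.^ j)     ≈⟨ sym (^-assocʳ x (p ℕ.* p) (p ℕ.^ j)) ⟩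
    (x ^ (p ℕ.* p)) ^ (p ℕ.^ j)   ∼⟨ mod-lift^ pp x^p²≡x^p j ⟩
    (x ^ p) ^ (p ℕ.^ j)           ≈⟨ ^-assocʳ x p (p ℕ.^ j) ⟩
    x ^ (p ℕ.* p ℕ.^ j)           ∎
    where open ≡-mod-Reasoning (⟨ p ⟩ ^ suc j)

-- Componentwise integer identities for the ring ℤ[ω] below, with every variable quantified
-- (including r₁ and r₂) so that the ring solver applies.
module QuadraticIntegerIdentities where

  open import Data.Integer using (-_; _+_; _*_; _-_)
  import Data.Integer.Properties as ℤP
  open import Data.Integer.Tactic.RingSolver using (solve-∀)
  open import Relation.Binary.PropositionalEquality

  ⊗-assoc₁ : ∀ r₂ r₁ a b c d e f → (a * c + r₂ * (b * d)) * e + r₂ * ((a * d + b * c + r₁ * (b * d)) * f)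
                                  ≡ a * (c * e + r₂ * (d * f)) + r₂ * (b * (c * f + d * e + r₁ * (d * f)))
  ⊗-assoc₁ = solve-∀
  ⊗-assoc₂ : ∀ r₂ r₁ a b c d e f → (a * c + r₂ * (b * d)) * f + (a * d + b * c + r₁ * (b * d)) * e + r₁ * ((a * d + b * c + r₁ * (b * d)) * f)
                                  ≡ a * (c * f + d * e + r₁ * (d * f)) + b * (c * e + r₂ * (d * f)) + r₁ * (b * (c * f + d * e + r₁ * (d * f)))
  ⊗-assoc₂ = solve-∀
  ⊗-comm₁ : ∀ r₂ a b c d → a * c + r₂ * (b * d) ≡ c * a + r₂ * (d * b)
  ⊗-comm₁ = solve-∀
  ⊗-comm₂ : ∀ r₁ a b c d → a * d + b * c + r₁ * (b * d) ≡ c * b + d * a + r₁ * (d * b)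
  ⊗-comm₂ = solve-∀
  ⊗-identityˡ₁ : ∀ r₂ a b → + 1 * a + r₂ * (+ 0 * b) ≡ a
  ⊗-identityˡ₁ = solve-∀
  ⊗-identityˡ₂ : ∀ r₁ a b → + 1 * b + + 0 * a + r₁ * (+ 0 * b) ≡ b
  ⊗-identityˡ₂ = solve-∀
  ⊗-distribˡ₁ : ∀ r₂ a b c d e f → a * (c + e) + r₂ * (b * (d + f)) ≡ (a * c + r₂ * (b * d)) + (a * e + r₂ * (b * f))
  ⊗-distribˡ₁ = solve-∀
  ⊗-distribˡ₂ : ∀ r₁ a b c d e f → a * (d + f) + b * (c + e) + r₁ * (b * (d + f)) ≡ (a * d + b * c + r₁ * (b * d)) + (a * f + b * e + r₁ * (b * f))
  ⊗-distribˡ₂ = solve-∀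

  ι-⊗₁ : ∀ r₂ c a b → c * a + r₂ * (+ 0 * b) ≡ c * a
  ι-⊗₁ = solve-∀
  ι-⊗₂ : ∀ r₁ c a b → c * b + + 0 * a + r₁ * (+ 0 * b) ≡ c * b
  ι-⊗₂ = solve-∀
  shift : ∀ t c v → t + c * v - t ≡ v * c
  shift = solve-∀
  ε²₁ : ∀ r₁ r₂ → - r₁ * - r₁ + r₂ * (+ 2 * + 2) ≡ r₁ * r₁ + + 4 * r₂
  ε²₁ = solve-∀
  ε²₂ : ∀ r₁ → - r₁ * + 2 + + 2 * - r₁ + r₁ * (+ 2 * + 2) ≡ + 0
  ε²₂ = solve-∀
  ι2⊗₁ : ∀ r₁ r₂ a b → + 2 * a + r₂ * (+ 0 * b) ≡ (+ 2 * a + b * r₁) + (b * - r₁ + r₂ * (+ 0 * + 2))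
  ι2⊗₁ = solve-∀
  ι2⊗₂ : ∀ r₁ a b → + 2 * b + + 0 * a + r₁ * (+ 0 * b) ≡ + 0 + (b * + 2 + + 0 * - r₁ + r₁ * (+ 0 * + 2))
  ι2⊗₂ = solve-∀
  regroup : ∀ b q p d → b * (q * p * d) ≡ p * (b * q * d)
  regroup = solve-∀
  decompose₁ : ∀ r₂ a b → a ≡ a + (b * + 0 + r₂ * (+ 0 * + 1))
  decompose₁ = solve-∀
  decompose₂ : ∀ r₁ b → b ≡ + 0 + (b * + 1 + + 0 * + 0 + r₁ * (+ 0 * + 1))
  decompose₂ = solve-∀
  φ₁ : ∀ r₁ r₂ a b → a + (b * r₂ + r₂ * (+ 0 * r₁)) ≡ a + b * r₂
  φ₁ = solve-∀
  φ₂ : ∀ r₁ r₂ b → + 0 + (b * r₁ + + 0 * r₂ + r₁ * (+ 0 * r₁)) ≡ b * r₁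
  φ₂ = solve-∀
  φφ-odd₁ : ∀ r₁ r₂ a b → a + b * r₂ + b * r₁ * r₂ - a ≡ b * r₂ * (r₁ + + 1)
  φφ-odd₁ = solve-∀
  φφ-odd₂ : ∀ r₁ b → b * r₁ * r₁ - b ≡ b * (r₁ - + 1) * (r₁ + + 1)
  φφ-odd₂ = solve-∀
  φφ-even₁ : ∀ r₁ r₂ a b → a + b * r₂ + b * r₁ * r₂ - (a + b * r₂) ≡ b * r₂ * r₁
  φφ-even₁ = solve-∀
  φφ-even₂ : ∀ r₁ b → b * r₁ * r₁ - b * r₁ ≡ b * (r₁ - + 1) * r₁
  φφ-even₂ = solve-∀
  D-odd : ∀ r₁ r₂ → r₁ * r₁ + + 4 * r₂ - ((r₁ + + 1) * (r₁ - + 1) + + 2 * (+ 2 * r₂)) ≡ + 1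
  D-odd = solve-∀
  ω²₁ : ∀ r₂ → + 0 * + 0 + r₂ * (+ 1 * + 1) ≡ r₂
  ω²₁ = solve-∀
  ω²₂ : ∀ r₁ → + 0 * + 1 + + 1 * + 0 + r₁ * (+ 1 * + 1) ≡ r₁
  ω²₂ = solve-∀
  Λ-⊕′ : ∀ a b c d u₀ u₁ → (a + c) * u₀ + (b + d) * u₁ ≡ a * u₀ + b * u₁ + (c * u₀ + d * u₁)
  Λ-⊕′ = solve-∀
  Λ-ι⊗′ : ∀ c a b u₀ u₁ → c * a * u₀ + c * b * u₁ ≡ c * (a * u₀ + b * u₁)
  Λ-ι⊗′ = solve-∀
  Λ-1 : ∀ u₀ u₁ → + 1 * u₀ + + 0 * u₁ ≡ u₀
  Λ-1 = solve-∀
  Λ-ω : ∀ u₀ u₁ → + 0 * u₀ + + 1 * u₁ ≡ u₁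
  Λ-ω = solve-∀
  Λ-difference : ∀ a b a′ b′ u₀ u₁ → a * u₀ + b * u₁ - (a′ * u₀ + b′ * u₁) ≡ (a - a′) * u₀ + (b - b′) * u₁
  Λ-difference = solve-∀
  factorˡ : ∀ a u v → a * u - a * v ≡ a * (u - v)
  factorˡ = solve-∀
  unshift′ : ∀ a a′ → a ≡ a′ + (a - a′)
  unshift′ = solve-∀
  unshift : ∀ a a′ c q → a - a′ ≡ q * c → a ≡ a′ + c * q
  unshift a a′ c q eq = trans (unshift′ a a′) (cong (λ t → a′ + t) (trans eq (ℤP.*-comm q c)))

module QuadraticIntegers (r₁ r₂ : ℤ) where

  open import Algebra.Structures using (IsCommutativeRing)
  open import Data.Integer using (-[1+_]; -_; _+_; _*_; _-_)
  import Data.Integer.Divisibility.Signed as ℤD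
  import Data.Integer.Properties as ℤP
  open import Data.Nat using (zero; s≤s; z≤n)
  open import Data.Nat.Divisibility using (_∣_; _∤_; ∣⇒≤; ∣1⇒≡1; _∣?_; divides)
  open import Data.Nat.Primality using (Prime; prime[2])
  import Data.Nat.Properties as ℕP
  open ℕP using (<⇒≱; +-suc; m≤m+n; m≤n+m)
  import Algebra.Properties.CommutativeSemigroup ℕP.*-commutativeSemigroup as ℕ*
  open import Data.Product using (_×_; _,_; ∃)
  open import Data.Sum using (_⊎_; inj₁; inj₂)
  open import Level using (0ℓ)
  open import Relation.Binary.PropositionalEquality
  open import Relation.Nullary using (¬_; contradiction; yes; no)
  open Arithmetic using (even-or-odd; prime-2-or-odd; +p∣a*z∧p∤a⇒+p∣z)
  open QuadraticIntegerIdentities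
  open DoldCriterion using (EulerCongruences)

  -- a +ω b stands for a + bω, where ω² = r₁ω + r₂.
  infix 5 _+ω_
  data ℤ[ω] : Set where
    _+ω_ : ℤ → ℤ → ℤ[ω]

  infixl 6 _⊕_
  infixl 7 _⊗_

  _⊕_ : ℤ[ω] → ℤ[ω] → ℤ[ω]
  (a +ω b) ⊕ (c +ω d) = (a + c) +ω (b + d)

  _⊗_ : ℤ[ω] → ℤ[ω] → ℤ[ω]
  (a +ω b) ⊗ (c +ω d) = (a * c + r₂ * (b * d)) +ω (a * d + b * c + r₁ * (b * d))

  ⊖_ : ℤ[ω] → ℤ[ω]
  ⊖ (a +ω b) = (- a) +ω (- b)

  ι : ℤ → ℤ[ω]
  ι a = a +ω + 0

  ω : ℤ[ω]
  ω = + 0 +ω + 1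

  isCommutativeRing : IsCommutativeRing _≡_ _⊕_ _⊗_ ⊖_ (ι (+ 0)) (ι (+ 1))
  isCommutativeRing = record
    { isRing = record
      { +-isAbelianGroup = record
        { isGroup = record
          { isMonoid = record
            { isSemigroup = record
              { isMagma = record { isEquivalence = isEquivalence ; ∙-cong = cong₂ _⊕_ }
              ; assoc = ⊕-assoc }
            ; identity = ⊕-identityˡ , λ x → trans (⊕-comm x _) (⊕-identityˡ x) }
          ; inverse = ⊕-inverseˡ , λ x → trans (⊕-comm x _) (⊕-inverseˡ x)
          ; ⁻¹-cong = cong ⊖_ }
        ; comm = ⊕-comm }
      ; *-cong = cong₂ _⊗_
      ; *-assoc = ⊗-assoc
      ; *-identity = ⊗-identityˡ , λ x → trans (⊗-comm x _) (⊗-identityˡ x)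
      ; distrib = ⊗-distribˡ , λ x y z → trans (⊗-comm (y ⊕ z) x) (trans (⊗-distribˡ x y z) (cong₂ _⊕_ (⊗-comm x y) (⊗-comm x z))) }
    ; *-comm = ⊗-comm }
    where
    ⊕-assoc : ∀ x y z → x ⊕ y ⊕ z ≡ x ⊕ (y ⊕ z)
    ⊕-assoc (a +ω b) (c +ω d) (e +ω f) = cong₂ _+ω_ (ℤP.+-assoc a c e) (ℤP.+-assoc b d f)
    ⊕-comm : ∀ x y → x ⊕ y ≡ y ⊕ x
    ⊕-comm (a +ω b) (c +ω d) = cong₂ _+ω_ (ℤP.+-comm a c) (ℤP.+-comm b d)
    ⊕-identityˡ : ∀ x → ι (+ 0) ⊕ x ≡ x
    ⊕-identityˡ (a +ω b) = cong₂ _+ω_ (ℤP.+-identityˡ a) (ℤP.+-identityˡ b)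
    ⊕-inverseˡ : ∀ x → ⊖ x ⊕ x ≡ ι (+ 0)
    ⊕-inverseˡ (a +ω b) = cong₂ _+ω_ (ℤP.+-inverseˡ a) (ℤP.+-inverseˡ b)
    ⊗-assoc : ∀ x y z → x ⊗ y ⊗ z ≡ x ⊗ (y ⊗ z)
    ⊗-assoc (a +ω b) (c +ω d) (e +ω f) = cong₂ _+ω_ (⊗-assoc₁ r₂ r₁ a b c d e f) (⊗-assoc₂ r₂ r₁ a b c d e f)
    ⊗-comm : ∀ x y → x ⊗ y ≡ y ⊗ x
    ⊗-comm (a +ω b) (c +ω d) = cong₂ _+ω_ (⊗-comm₁ r₂ a b c d) (⊗-comm₂ r₁ a b c d)
    ⊗-identityˡ : ∀ x → ι (+ 1) ⊗ x ≡ x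
    ⊗-identityˡ (a +ω b) = cong₂ _+ω_ (⊗-identityˡ₁ r₂ a b) (⊗-identityˡ₂ r₁ a b)
    ⊗-distribˡ : ∀ x y z → x ⊗ (y ⊕ z) ≡ x ⊗ y ⊕ x ⊗ z
    ⊗-distribˡ (a +ω b) (c +ω d) (e +ω f) = cong₂ _+ω_ (⊗-distribˡ₁ r₂ a b c d e f) (⊗-distribˡ₂ r₁ a b c d e f)

  commutativeRing : CommutativeRing 0ℓ 0ℓ
  commutativeRing = record { isCommutativeRing = isCommutativeRing }

  open Congruence commutativeRing
  open CommutativeRing commutativeRing using (*-assoc; *-comm; *-identityʳ; distribʳ)
  open import Algebra.Definitions.RawMagma (CommutativeRing.*-rawMagma commutativeRing) using (_,_)
  open import Algebra.Properties.CommutativeSemiring.Exp (CommutativeRing.commutativeSemiring commutativeRing) using (_^_; ^-distrib-*; ^-homo-*; ^-assocʳ)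

  +ω-injective : ∀ {a b c d} → a +ω b ≡ c +ω d → a ≡ c × b ≡ d
  +ω-injective refl = refl , refl

  ι-⊗ : ∀ c a b → ι c ⊗ (a +ω b) ≡ (c * a) +ω (c * b)
  ι-⊗ c a b = cong₂ _+ω_ (ι-⊗₁ r₂ c a b) (ι-⊗₂ r₁ c a b)

  ι-* : ∀ a b → ι (a * b) ≡ ι a ⊗ ι b
  ι-* a b = sym (trans (ι-⊗ a b (+ 0)) (cong ((a * b) +ω_) (ℤP.*-zeroʳ a)))

  ι-^ : ∀ a n → ι a ^ n ≡ ι (a ℤ.^ n)
  ι-^ a zero = refl
  ι-^ a (suc n) = trans (cong (ι a ⊗_) (ι-^ a n)) (sym (ι-* a (a ℤ.^ n)))

  ⟨⟩≡ι : ∀ n → ⟨ n ⟩ ≡ ι (+ n)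
  ⟨⟩≡ι zero = refl
  ⟨⟩≡ι (suc n) = cong (ι (+ 1) ⊕_) (⟨⟩≡ι n)

  ω⊗ω : ω ⊗ ω ≡ r₂ +ω r₁
  ω⊗ω = cong₂ _+ω_ (ω²₁ r₂) (ω²₂ r₁)

  decompose : ∀ a b → a +ω b ≡ ι a ⊕ ι b ⊗ ω
  decompose a b = cong₂ _+ω_ (decompose₁ r₂ a b) (decompose₂ r₁ b)

  mod-ι⇒∣ : ∀ {c a b a′ b′} → a +ω b ≡ a′ +ω b′ [mod ι c ] → c ℤD.∣ a - a′ × c ℤD.∣ b - b′
  mod-ι⇒∣ {c} {a} {b} {a′} {b′} (w₁ +ω w₂ , eq) with +ω-injective (trans eq (cong ((a′ +ω b′) ⊕_) (ι-⊗ c w₁ w₂)))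
  ... | a≡ , b≡ = ℤD.divides w₁ (difference a′ a≡) , ℤD.divides w₂ (difference b′ b≡)
    where
    difference : ∀ {u v} t → u ≡ t + c * v → u - t ≡ v * c
    difference {u} {v} t refl = shift t c v

  ∣⇒mod-ι : ∀ {c a b a′ b′} → c ℤD.∣ a - a′ → c ℤD.∣ b - b′ → a +ω b ≡ a′ +ω b′ [mod ι c ]
  ∣⇒mod-ι {c} {a} {b} {a′} {b′} (ℤD.divides q₁ a-a′≡q₁c) (ℤD.divides q₂ b-b′≡q₂c) = q₁ +ω q₂ ,
    trans (cong₂ _+ω_ (unshift a a′ c q₁ a-a′≡q₁c) (unshift b b′ c q₂ b-b′≡q₂c)) (sym (cong ((a′ +ω b′) ⊕_) (ι-⊗ c q₁ q₂)))

  module _ {p} (pp : Prime p) where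

    fermat-ι : ∀ a → ι a ^ p ≡ ι a [mod ⟨ p ⟩ ]
    fermat-ι (+ n) = subst (λ z → z ^ p ≡ z [mod ⟨ p ⟩ ]) (⟨⟩≡ι n) (fermat pp n)
    fermat-ι -[1+ n ] = subst (λ z → (⊖ z) ^ p ≡ ⊖ z [mod ⟨ p ⟩ ]) (⟨⟩≡ι (suc n))
      (mod-trans (-‿^-prime pp ⟨ suc n ⟩) (mod-neg (fermat pp (suc n))))

    frobenius-linear : ∀ a b x → (ι a ⊕ ι b ⊗ x) ^ p ≡ ι a ⊕ ι b ⊗ x ^ p [mod ⟨ p ⟩ ]
    frobenius-linear a b x = mod-trans (frobenius-mod-p pp (ι a) (ι b ⊗ x))
      (mod-+ (fermat-ι a) (mod-trans (≈⇒≡mod (^-distrib-* (ι b) x p)) (mod-* (fermat-ι b) (≈⇒≡mod refl))))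

    mod-cancel-ι : ∀ a {x y} → p ∤ ℤ.∣ a ∣ → ι a ⊗ x ≡ ι a ⊗ y [mod ⟨ p ⟩ ] → x ≡ y [mod ⟨ p ⟩ ]
    mod-cancel-ι a {x₁ +ω x₂} {y₁ +ω y₂} p∤a ax≡ay
      with p∣ax₁-ay₁ , p∣ax₂-ay₂ ← mod-ι⇒∣ (subst₂ (λ u v → u ≡ v [mod ι (+ p) ]) (ι-⊗ a x₁ x₂) (ι-⊗ a y₁ y₂)
                                                   (subst (λ m → _ ≡ _ [mod m ]) (⟨⟩≡ι p) ax≡ay))
      = subst (λ m → _ ≡ _ [mod m ]) (sym (⟨⟩≡ι p)) (∣⇒mod-ι (cancel p∣ax₁-ay₁) (cancel p∣ax₂-ay₂))
      where
      cancel : ∀ {u v} → + p ℤD.∣ a * u - a * v → + p ℤD.∣ u - v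
      cancel {u} {v} = +p∣a*z∧p∤a⇒+p∣z a pp p∤a ∘ subst (+ p ℤD.∣_) (factorˡ a u v)

    fermat²-ι : ∀ a → ι a ^ (p ℕ.* p) ≡ ι a [mod ⟨ p ⟩ ]
    fermat²-ι a = begin
      ι a ^ (p ℕ.* p)    ≡⟨ sym (^-assocʳ (ι a) p p) ⟩
      (ι a ^ p) ^ p      ∼⟨ mod-^ (fermat-ι a) p ⟩
      ι a ^ p            ∼⟨ fermat-ι a ⟩
      ι a                ∎
      where open ≡-mod-Reasoning ⟨ p ⟩

    halve : p ∤ 2 → ∀ {γ δ} → (ι (+ 2) ⊗ γ) ^ (p ℕ.* p) ≡ ι (+ 2) ⊗ δ [mod ⟨ p ⟩ ] → γ ^ (p ℕ.* p) ≡ δ [mod ⟨ p ⟩ ]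
    halve p∤2 {γ} {δ} [2γ]^pp≡2δ = mod-cancel-ι (+ 2) p∤2 (begin
      ι (+ 2) ⊗ γ ^ (p ℕ.* p)                    ∼⟨ mod-*ʳ (γ ^ (p ℕ.* p)) (mod-sym (fermat²-ι (+ 2))) ⟩
      ι (+ 2) ^ (p ℕ.* p) ⊗ γ ^ (p ℕ.* p)        ≡⟨ sym (^-distrib-* (ι (+ 2)) γ (p ℕ.* p)) ⟩
      (ι (+ 2) ⊗ γ) ^ (p ℕ.* p)                  ∼⟨ [2γ]^pp≡2δ ⟩
      ι (+ 2) ⊗ δ                                 ∎)
      where open ≡-mod-Reasoning ⟨ p ⟩

  D : ℤ
  D = r₁ * r₁ + + 4 * r₂

  ε : ℤ[ω]
  ε = (- r₁) +ω + 2

  ε⊗ε≡ιD : ε ⊗ ε ≡ ι D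
  ε⊗ε≡ιD = cong₂ _+ω_ (ε²₁ r₁ r₂) (ε²₂ r₁)

  ι2⊗≡ι⊕ι⊗ε : ∀ a b → ι (+ 2) ⊗ (a +ω b) ≡ ι (+ 2 * a + b * r₁) ⊕ ι b ⊗ ε
  ι2⊗≡ι⊕ι⊗ε a b = cong₂ _+ω_ (ι2⊗₁ r₁ r₂ a b) (ι2⊗₂ r₁ a b)

  ε^odd : ∀ h → ε ^ suc (h ℕ.+ h) ≡ ι (D ℤ.^ h) ⊗ ε
  ε^odd h = begin
    ε ⊗ ε ^ (h ℕ.+ h)     ≡⟨ cong (ε ⊗_) (^-homo-* ε h h) ⟩
    ε ⊗ (ε ^ h ⊗ ε ^ h)   ≡⟨ cong (ε ⊗_) (sym (^-distrib-* ε ε h)) ⟩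
    ε ⊗ (ε ⊗ ε) ^ h       ≡⟨ cong (λ z → ε ⊗ z ^ h) ε⊗ε≡ιD ⟩
    ε ⊗ ι D ^ h           ≡⟨ cong (ε ⊗_) (ι-^ D h) ⟩
    ε ⊗ ι (D ℤ.^ h)       ≡⟨ *-comm ε (ι (D ℤ.^ h)) ⟩
    ι (D ℤ.^ h) ⊗ ε       ∎
    where open ≡-Reasoning

  -- For odd p, 2γ is written in the basis 1, ε. Since ε² = D, Frobenius fixes the first
  -- coordinate and multiplies the second by s = D^((p−1)/2); then s² ≡ 1 if p ∤ D and s ≡ 0 if p ∣ D.
  module OddPrime {p} (pp : Prime p) (h : ℕ) (p≡2h+3 : p ≡ suc (suc h ℕ.+ suc h)) where

    private
      s = D ℤ.^ suc h

    p∤2 : p ∤ 2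
    p∤2 p∣2 = <⇒≱ (subst (2 ℕ.<_) (sym p≡2h+3) (s≤s (s≤s (subst (1 ℕ.≤_) (sym (+-suc h h)) (s≤s z≤n))))) (∣⇒≤ p∣2)

    frobenius-ε : ∀ a b → (ι a ⊕ ι b ⊗ ε) ^ p ≡ ι a ⊕ ι (b * s) ⊗ ε [mod ⟨ p ⟩ ]
    frobenius-ε a b = begin
      (ι a ⊕ ι b ⊗ ε) ^ p       ∼⟨ frobenius-linear pp a b ε ⟩
      ι a ⊕ ι b ⊗ ε ^ p         ≡⟨ cong (λ z → ι a ⊕ ι b ⊗ z) (trans (cong (ε ^_) p≡2h+3) (ε^odd (suc h))) ⟩
      ι a ⊕ ι b ⊗ (ι s ⊗ ε)     ≡⟨ cong (ι a ⊕_) (sym (trans (cong (_⊗ ε) (ι-* b s)) (*-assoc (ι b) (ι s) ε))) ⟩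
      ι a ⊕ ι (b * s) ⊗ ε       ∎
      where open ≡-mod-Reasoning ⟨ p ⟩

    unramified-odd : p ∤ ℤ.∣ D ∣ → ∀ γ → γ ^ (p ℕ.* p) ≡ γ [mod ⟨ p ⟩ ]
    unramified-odd p∤D (a +ω b) = halve pp p∤2 (begin
      (ι (+ 2) ⊗ (a +ω b)) ^ (p ℕ.* p)    ≡⟨ cong (_^ (p ℕ.* p)) (ι2⊗≡ι⊕ι⊗ε a b) ⟩
      g ^ (p ℕ.* p)                       ≡⟨ sym (^-assocʳ g p p) ⟩
      (g ^ p) ^ p                         ∼⟨ mod-^ (frobenius-ε A b) p ⟩
      (ι A ⊕ ι (b * s) ⊗ ε) ^ p           ∼⟨ frobenius-ε A (b * s) ⟩
      ι A ⊕ ι (b * s * s) ⊗ ε             ∼⟨ mod-+ˡ (ι A) (mod-*ʳ ε bss≡b) ⟩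
      g                                   ≡⟨ sym (ι2⊗≡ι⊕ι⊗ε a b) ⟩
      ι (+ 2) ⊗ (a +ω b)                  ∎)
      where
      open ≡-mod-Reasoning ⟨ p ⟩
      A = + 2 * a + b * r₁
      g = ι A ⊕ ι b ⊗ ε
      s²≡1 : ι (s * s) ≡ ι (+ 1) [mod ⟨ p ⟩ ]
      s²≡1 = mod-cancel-ι pp D p∤D (begin
        ι D ⊗ ι (s * s)       ≡⟨ sym (ι-* D (s * s)) ⟩
        ι (D * (s * s))       ≡⟨ cong (λ e → ι (D * e)) (sym (ℤP.^-distribˡ-+-* D (suc h) (suc h))) ⟩
        ι (D ℤ.^ suc (suc h ℕ.+ suc h)) ≡⟨ cong (λ e → ι (D ℤ.^ e)) (sym p≡2h+3) ⟩
        ι (D ℤ.^ p)           ≡⟨ sym (ι-^ D p) ⟩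
        ι D ^ p               ∼⟨ fermat-ι pp D ⟩
        ι D                   ≡⟨ sym (*-identityʳ (ι D)) ⟩
        ι D ⊗ ι (+ 1)         ∎)
      bss≡b : ι (b * s * s) ≡ ι b [mod ⟨ p ⟩ ]
      bss≡b = begin
        ι (b * s * s)         ≡⟨ trans (cong ι (ℤP.*-assoc b s s)) (ι-* b (s * s)) ⟩
        ι b ⊗ ι (s * s)       ∼⟨ mod-*ˡ (ι b) s²≡1 ⟩
        ι b ⊗ ι (+ 1)         ≡⟨ *-identityʳ (ι b) ⟩
        ι b                   ∎

    ramified-odd : p ∣ ℤ.∣ D ∣ → ∀ γ → γ ^ (p ℕ.* p) ≡ γ ^ p [mod ⟨ p ⟩ ]
    ramified-odd p∣D (a +ω b) = halve pp p∤2 (begin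
      (ι (+ 2) ⊗ (a +ω b)) ^ (p ℕ.* p)    ≡⟨ cong (_^ (p ℕ.* p)) (ι2⊗≡ι⊕ι⊗ε a b) ⟩
      g ^ (p ℕ.* p)                       ≡⟨ sym (^-assocʳ g p p) ⟩
      (g ^ p) ^ p                         ∼⟨ mod-^ g^p≡ιA p ⟩
      ι A ^ p                             ∼⟨ fermat-ι pp A ⟩
      ι A                                 ∼⟨ mod-sym g^p≡ιA ⟩
      g ^ p                               ≡⟨ cong (_^ p) (sym (ι2⊗≡ι⊕ι⊗ε a b)) ⟩
      (ι (+ 2) ⊗ (a +ω b)) ^ p            ≡⟨ ^-distrib-* (ι (+ 2)) (a +ω b) p ⟩
      ι (+ 2) ^ p ⊗ (a +ω b) ^ p          ∼⟨ mod-*ʳ ((a +ω b) ^ p) (fermat-ι pp (+ 2)) ⟩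
      ι (+ 2) ⊗ (a +ω b) ^ p              ∎)
      where
      open ≡-mod-Reasoning ⟨ p ⟩
      A = + 2 * a + b * r₁
      g = ι A ⊕ ι b ⊗ ε
      bsε≡0 : ι (b * s) ⊗ ε ≡ ι (+ 0) [mod ⟨ p ⟩ ]
      bsε≡0 with ℤD.∣ᵤ⇒∣ {+ p} {D} p∣D
      ... | ℤD.divides q D≡qp = begin
        ι (b * s) ⊗ ε                               ≡⟨ cong (λ d → ι (b * (d * D ℤ.^ h)) ⊗ ε) D≡qp ⟩
        ι (b * (q * + p * D ℤ.^ h)) ⊗ ε             ≡⟨ cong (λ z → ι z ⊗ ε) (regroup b q (+ p) (D ℤ.^ h)) ⟩
        ι (+ p * (b * q * D ℤ.^ h)) ⊗ ε             ≡⟨ trans (cong (_⊗ ε) (ι-* (+ p) _)) (*-assoc (ι (+ p)) _ ε) ⟩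
        ι (+ p) ⊗ (ι (b * q * D ℤ.^ h) ⊗ ε)         ≡⟨ cong (_⊗ _) (sym (⟨⟩≡ι p)) ⟩
        ⟨ p ⟩ ⊗ (ι (b * q * D ℤ.^ h) ⊗ ε)           ∼⟨ multiple≡0 ⟨ p ⟩ _ ⟩
        ι (+ 0)                                     ∎
      g^p≡ιA : g ^ p ≡ ι A [mod ⟨ p ⟩ ]
      g^p≡ιA = begin
        g ^ p                     ∼⟨ frobenius-ε A b ⟩
        ι A ⊕ ι (b * s) ⊗ ε       ∼⟨ mod-+ˡ (ι A) bsε≡0 ⟩
        ι A ⊕ ι (+ 0)             ≡⟨ cong (_+ω + 0) (ℤP.+-identityʳ A) ⟩
        ι A                       ∎

  -- Frobenius modulo 2, computed from ω² = r₂ + r₁ω.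
  φ : ℤ[ω] → ℤ[ω]
  φ (a +ω b) = (a + b * r₂) +ω (b * r₁)

  square≡φ : ∀ γ → γ ^ 2 ≡ φ γ [mod ⟨ 2 ⟩ ]
  square≡φ (a +ω b) = begin
    (a +ω b) ^ 2                      ≡⟨ cong (_^ 2) (decompose a b) ⟩
    (ι a ⊕ ι b ⊗ ω) ^ 2               ∼⟨ frobenius-linear prime[2] a b ω ⟩
    ι a ⊕ ι b ⊗ (ω ⊗ (ω ⊗ ι (+ 1)))   ≡⟨ cong (λ z → ι a ⊕ ι b ⊗ (ω ⊗ z)) (*-identityʳ ω) ⟩
    ι a ⊕ ι b ⊗ (ω ⊗ ω)               ≡⟨ cong (λ z → ι a ⊕ ι b ⊗ z) ω⊗ω ⟩
    ι a ⊕ ι b ⊗ (r₂ +ω r₁)            ≡⟨ cong₂ _+ω_ (φ₁ r₁ r₂ a b) (φ₂ r₁ r₂ b) ⟩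
    φ (a +ω b)                        ∎
    where open ≡-mod-Reasoning ⟨ 2 ⟩

  fourth≡φφ : ∀ γ → γ ^ (2 ℕ.* 2) ≡ φ (φ γ) [mod ⟨ 2 ⟩ ]
  fourth≡φφ γ = begin
    γ ^ (2 ℕ.* 2)      ≡⟨ sym (^-assocʳ γ 2 2) ⟩
    (γ ^ 2) ^ 2        ∼⟨ mod-^ (square≡φ γ) 2 ⟩
    φ γ ^ 2            ∼⟨ square≡φ (φ γ) ⟩
    φ (φ γ)            ∎
    where open ≡-mod-Reasoning ⟨ 2 ⟩

  unramified-2 : + 2 ℤD.∣ r₁ + + 1 → ∀ γ → γ ^ (2 ℕ.* 2) ≡ γ [mod ⟨ 2 ⟩ ]
  unramified-2 2∣r₁+1 (a +ω b) = mod-trans (fourth≡φφ (a +ω b)) (∣⇒mod-ι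
    (subst (+ 2 ℤD.∣_) (sym (φφ-odd₁ r₁ r₂ a b)) (ℤD.∣n⇒∣m*n (b * r₂) 2∣r₁+1))
    (subst (+ 2 ℤD.∣_) (sym (φφ-odd₂ r₁ b)) (ℤD.∣n⇒∣m*n (b * (r₁ - + 1)) 2∣r₁+1)))

  ramified-2 : + 2 ℤD.∣ r₁ → ∀ γ → γ ^ (2 ℕ.* 2) ≡ γ ^ 2 [mod ⟨ 2 ⟩ ]
  ramified-2 2∣r₁ (a +ω b) = mod-trans (fourth≡φφ (a +ω b)) (mod-trans (∣⇒mod-ι
    (subst (+ 2 ℤD.∣_) (sym (φφ-even₁ r₁ r₂ a b)) (ℤD.∣n⇒∣m*n (b * r₂) 2∣r₁))
    (subst (+ 2 ℤD.∣_) (sym (φφ-even₂ r₁ b)) (ℤD.∣n⇒∣m*n (b * (r₁ - + 1)) 2∣r₁))) (mod-sym (square≡φ (a +ω b))))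

  even⇒2∣D : + 2 ℤD.∣ r₁ → + 2 ℤD.∣ D
  even⇒2∣D 2∣r₁ = ℤD.∣m∣n⇒∣m+n (ℤD.∣n⇒∣m*n r₁ 2∣r₁) (ℤD.∣m⇒∣m*n r₂ (ℤD.divides (+ 2) refl))

  odd⇒2∤D : + 2 ℤD.∣ r₁ + + 1 → ¬ (+ 2 ℤD.∣ D)
  odd⇒2∤D 2∣r₁+1 2∣D = contradiction (∣1⇒≡1 (ℤD.∣⇒∣ᵤ 2∣1)) λ ()
    where
    2∣1 : + 2 ℤD.∣ + 1
    2∣1 = subst (+ 2 ℤD.∣_) (D-odd r₁ r₂)
            (ℤD.∣m∣n⇒∣m-n 2∣D (ℤD.∣m∣n⇒∣m+n (ℤD.∣m⇒∣m*n (r₁ - + 1) 2∣r₁+1) (ℤD.∣m⇒∣m*n (+ 2 * r₂) ℤD.∣-refl)))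

  private
    unramified-2-or-odd : ∀ {p} → Prime p → p ∤ ℤ.∣ D ∣ → p ≡ 2 ⊎ ∃ (λ h → p ≡ suc (suc h ℕ.+ suc h)) →
                          + 2 ℤD.∣ r₁ ⊎ + 2 ℤD.∣ r₁ + + 1 → ∀ γ → γ ^ (p ℕ.* p) ≡ γ [mod ⟨ p ⟩ ]
    unramified-2-or-odd pp p∤D (inj₂ (h , p≡2h+3)) _ = OddPrime.unramified-odd pp h p≡2h+3 p∤D
    unramified-2-or-odd pp p∤D (inj₁ refl) (inj₁ 2∣r₁) = contradiction (ℤD.∣⇒∣ᵤ (even⇒2∣D 2∣r₁)) p∤D
    unramified-2-or-odd pp p∤D (inj₁ refl) (inj₂ 2∣r₁+1) = unramified-2 2∣r₁+1

  unramified : ∀ {p} → Prime p → p ∤ ℤ.∣ D ∣ → ∀ γ → γ ^ (p ℕ.* p) ≡ γ [mod ⟨ p ⟩ ]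
  unramified pp p∤D = unramified-2-or-odd pp p∤D (prime-2-or-odd pp) (even-or-odd r₁)

  private
    ramified-2-or-odd : ∀ {p} → Prime p → p ∣ ℤ.∣ D ∣ → p ≡ 2 ⊎ ∃ (λ h → p ≡ suc (suc h ℕ.+ suc h)) →
                        + 2 ℤD.∣ r₁ ⊎ + 2 ℤD.∣ r₁ + + 1 → ∀ γ → γ ^ (p ℕ.* p) ≡ γ ^ p [mod ⟨ p ⟩ ]
    ramified-2-or-odd pp p∣D (inj₂ (h , p≡2h+3)) _ = OddPrime.ramified-odd pp h p≡2h+3 p∣D
    ramified-2-or-odd pp p∣D (inj₁ refl) (inj₁ 2∣r₁) = ramified-2 2∣r₁
    ramified-2-or-odd pp p∣D (inj₁ refl) (inj₂ 2∣r₁+1) = contradiction (ℤD.∣ᵤ⇒∣ p∣D) (odd⇒2∤D 2∣r₁+1)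

  ramified : ∀ {p} → Prime p → p ∣ ℤ.∣ D ∣ → ∀ γ → γ ^ (p ℕ.* p) ≡ γ ^ p [mod ⟨ p ⟩ ]
  ramified pp p∣D = ramified-2-or-odd pp p∣D (prime-2-or-odd pp) (even-or-odd r₁)

  module _ {p} (pp : Prime p) where

    private
      c = ℤ.∣ D ∣

    ⟨⟩^≡ι : ∀ k → ⟨ p ⟩ ^ k ≡ ι (+ (p ℕ.^ k))
    ⟨⟩^≡ι zero = refl
    ⟨⟩^≡ι (suc k) = trans (cong₂ _⊗_ (⟨⟩≡ι p) (⟨⟩^≡ι k)) (trans (sym (ι-* (+ p) _)) (cong ι (sym (ℤP.pos-* p (p ℕ.^ k)))))

    -- If p ∣ D the lifting only reaches p^k; the factor ∣D∣, itself divisible by p, supplies the last p.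
    scaledEulerCongruence : ∀ γ k → ι (+ c) ⊗ γ ^ (p ℕ.^ (suc k ℕ.+ suc k)) ≡ ι (+ c) ⊗ γ ^ (p ℕ.^ (k ℕ.+ k)) [mod ⟨ p ⟩ ^ suc k ]
    scaledEulerCongruence γ k with p ∣? c
    ... | no p∤D = mod-*ˡ (ι (+ c)) (mod-∣ (^-∣ ⟨ p ⟩ (s≤s (m≤m+n k k))) (begin
      γ ^ (p ℕ.^ (suc k ℕ.+ suc k))        ≡⟨ cong (λ e → γ ^ (p ℕ.* p ℕ.^ e)) (+-suc k k) ⟩
      γ ^ (p ℕ.* (p ℕ.* p ℕ.^ (k ℕ.+ k)))  ≡⟨ cong (γ ^_) (sym (ℕP.*-assoc p p _)) ⟩
      γ ^ (p ℕ.* p ℕ.* p ℕ.^ (k ℕ.+ k))    ≡⟨ sym (^-assocʳ γ (p ℕ.* p) _) ⟩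
      (γ ^ (p ℕ.* p)) ^ (p ℕ.^ (k ℕ.+ k))  ∼⟨ mod-lift^ pp (unramified pp p∤D γ) (k ℕ.+ k) ⟩
      γ ^ (p ℕ.^ (k ℕ.+ k))                ∎))
      where open ≡-mod-Reasoning (⟨ p ⟩ ^ suc (k ℕ.+ k))
    ... | yes (divides d c≡dp) = mod-∣ (ι (+ d) , d⟨p⟩^k+1≡c⟨p⟩^k) (mod-scale (ι (+ c)) (begin
      γ ^ (p ℕ.^ (suc k ℕ.+ suc k))        ≡⟨ cong (λ e → γ ^ (p ℕ.^ suc e)) (+-suc k k) ⟩
      γ ^ (p ℕ.^ suc (suc (k ℕ.+ k)))      ∼⟨ mod-∣ (^-∣ ⟨ p ⟩ (m≤n+m k (suc k))) (lifted (suc (k ℕ.+ k))) ⟩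
      γ ^ (p ℕ.^ suc (k ℕ.+ k))            ∼⟨ mod-∣ (^-∣ ⟨ p ⟩ (m≤m+n k k)) (lifted (k ℕ.+ k)) ⟩
      γ ^ (p ℕ.^ (k ℕ.+ k))                ∎))
      where
      open ≡-mod-Reasoning (⟨ p ⟩ ^ k)
      lifted : ∀ j → γ ^ (p ℕ.^ suc j) ≡ γ ^ (p ℕ.^ j) [mod ⟨ p ⟩ ^ j ]
      lifted = frobeniusFixed⇒mod-lift pp (ramified pp (divides d c≡dp) γ)
      d⟨p⟩^k+1≡c⟨p⟩^k : ι (+ d) ⊗ ⟨ p ⟩ ^ suc k ≡ ι (+ c) ⊗ ⟨ p ⟩ ^ k
      d⟨p⟩^k+1≡c⟨p⟩^k = trans (sym (*-assoc (ι (+ d)) ⟨ p ⟩ _)) (cong (_⊗ ⟨ p ⟩ ^ k)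
        (trans (cong (ι (+ d) ⊗_) (⟨⟩≡ι p)) (trans (sym (ι-* (+ d) (+ p))) (cong ι (trans (sym (ℤP.pos-* d p)) (cong +_ (sym c≡dp)))))))

  module Sequence (U : ℕ → ℤ) (recurrence : ∀ n → U (suc (suc n)) ≡ r₁ * U (suc n) + r₂ * U n) where

    Λ : ℤ[ω] → ℤ
    Λ (a +ω b) = a * U 0 + b * U 1

    Λ-⊕ : ∀ x y → Λ (x ⊕ y) ≡ Λ x + Λ y
    Λ-⊕ (a +ω b) (c +ω d) = Λ-⊕′ a b c d (U 0) (U 1)

    Λ-ι⊗ : ∀ c x → Λ (ι c ⊗ x) ≡ c * Λ x
    Λ-ι⊗ c (a +ω b) = trans (cong Λ (ι-⊗ c a b)) (Λ-ι⊗′ c a b (U 0) (U 1))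

    Λ-ω^ : ∀ n → Λ (ω ^ n) ≡ U n
    Λ-ω^ zero = Λ-1 (U 0) (U 1)
    Λ-ω^ (suc zero) = trans (cong Λ (*-identityʳ ω)) (Λ-ω (U 0) (U 1))
    Λ-ω^ (suc (suc n)) = begin
      Λ (ω ⊗ (ω ⊗ ω ^ n))                           ≡⟨ cong Λ (trans (sym (*-assoc ω ω _)) (cong (_⊗ ω ^ n) (trans ω⊗ω (decompose r₂ r₁)))) ⟩
      Λ ((ι r₂ ⊕ ι r₁ ⊗ ω) ⊗ ω ^ n)
        ≡⟨ cong Λ (trans (distribʳ (ω ^ n) (ι r₂) (ι r₁ ⊗ ω)) (cong (ι r₂ ⊗ ω ^ n ⊕_) (*-assoc (ι r₁) ω (ω ^ n)))) ⟩
      Λ (ι r₂ ⊗ ω ^ n ⊕ ι r₁ ⊗ (ω ⊗ ω ^ n))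
        ≡⟨ trans (Λ-⊕ (ι r₂ ⊗ ω ^ n) (ι r₁ ⊗ (ω ⊗ ω ^ n))) (cong₂ _+_ (Λ-ι⊗ r₂ (ω ^ n)) (Λ-ι⊗ r₁ (ω ^ suc n))) ⟩
      r₂ * Λ (ω ^ n) + r₁ * Λ (ω ^ suc n)           ≡⟨ cong₂ (λ u v → r₂ * u + r₁ * v) (Λ-ω^ n) (Λ-ω^ (suc n)) ⟩
      r₂ * U n + r₁ * U (suc n)                     ≡⟨ trans (ℤP.+-comm (r₂ * U n) (r₁ * U (suc n))) (sym (recurrence n)) ⟩
      U (suc (suc n))                               ∎
      where open ≡-Reasoning

    Λ-mod : ∀ {c x y} → x ≡ y [mod ι c ] → c ℤD.∣ Λ x - Λ y
    Λ-mod {c} {a +ω b} {a′ +ω b′} x≡y with mod-ι⇒∣ x≡y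
    ... | c∣a-a′ , c∣b-b′ = subst (c ℤD.∣_) (sym (Λ-difference a b a′ b′ (U 0) (U 1)))
      (ℤD.∣m∣n⇒∣m+n (ℤD.∣m⇒∣m*n (U 0) c∣a-a′) (ℤD.∣m⇒∣m*n (U 1) c∣b-b′))

    euler : EulerCongruences (λ n → + ℤ.∣ D ∣ * U (n ℕ.* n))
    euler {p} k _ pp (divides q refl) = subst₂ (λ u v → + (p ℕ.^ suc k) ℤD.∣ u - v)
      (trans (sym (value (suc k))) (cong (λ n → + c * U (n ℕ.* n)) (sym (ℕ*.x∙yz≈y∙xz p q (p ℕ.^ k))))) (sym (value k))
      (Λ-mod congruence)
      where
      c = ℤ.∣ D ∣
      γ = ω ^ (q ℕ.* q)
      congruence : ι (+ c) ⊗ γ ^ (p ℕ.^ (suc k ℕ.+ suc k)) ≡ ι (+ c) ⊗ γ ^ (p ℕ.^ (k ℕ.+ k)) [mod ι (+ (p ℕ.^ suc k)) ]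
      congruence = subst (λ m → ι (+ c) ⊗ γ ^ (p ℕ.^ (suc k ℕ.+ suc k)) ≡ ι (+ c) ⊗ γ ^ (p ℕ.^ (k ℕ.+ k)) [mod m ])
                         (⟨⟩^≡ι pp (suc k)) (scaledEulerCongruence pp γ k)
      open ≡-Reasoning
      value : ∀ j → + c * U ((q ℕ.* p ℕ.^ j) ℕ.* (q ℕ.* p ℕ.^ j)) ≡ Λ (ι (+ c) ⊗ (ω ^ (q ℕ.* q)) ^ (p ℕ.^ (j ℕ.+ j)))
      value j = begin
        + c * U ((q ℕ.* p ℕ.^ j) ℕ.* (q ℕ.* p ℕ.^ j))
          ≡⟨ cong (λ e → + c * U e) (trans (ℕ*.interchange q (p ℕ.^ j) q (p ℕ.^ j)) (cong (q ℕ.* q ℕ.*_) (sym (ℕP.^-distribˡ-+-* p j j)))) ⟩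
        + c * U (q ℕ.* q ℕ.* p ℕ.^ (j ℕ.+ j))          ≡⟨ cong (λ z → + c * z) (sym (Λ-ω^ (q ℕ.* q ℕ.* p ℕ.^ (j ℕ.+ j)))) ⟩
        + c * Λ (ω ^ (q ℕ.* q ℕ.* p ℕ.^ (j ℕ.+ j)))    ≡⟨ cong (λ z → + c * Λ z) (sym (^-assocʳ ω (q ℕ.* q) _)) ⟩
        + c * Λ ((ω ^ (q ℕ.* q)) ^ (p ℕ.^ (j ℕ.+ j)))  ≡⟨ sym (Λ-ι⊗ (+ c) ((ω ^ (q ℕ.* q)) ^ (p ℕ.^ (j ℕ.+ j)))) ⟩
        Λ (ι (+ c) ⊗ (ω ^ (q ℕ.* q)) ^ (p ℕ.^ (j ℕ.+ j))) ∎

theorem4 : (r₁ r₂ : ℤ) (U : ℕ → ℤ) →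
    (∀ (n : ℕ) → U (suc (suc n)) ≡ r₁ ℤ.* U (suc n) ℤ.+ r₂ ℤ.* U n) →
    r₁ ℤ.* r₁ ℤ.+ + 4 ℤ.* r₂ ≢ + 0 →
    AlmostDold (λ n → U (n ℕ.* n))
theorem4 r₁ r₂ U recurrence D≢0 =
  ℤ.∣ D ∣ , n≢0⇒n>0 (D≢0 ∘ ∣i∣≡0⇒i≡0) ,
  DoldCriterion.euler⇒dold {B = λ n → + ℤ.∣ D ∣ ℤ.* U (n ℕ.* n)} (Sequence.euler U recurrence)
  where open QuadraticIntegers r₁ r₂
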